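{- For every $n\ge 1$, \[\sum_{\sigma\in D_n} sign(\sigma)\,q^{\text{flag-major}_N(\sigma)}=(1-q^2)^{\lfloor n/2\rfloor}\,[n]_{\pm q^2}!.\]
   Context: $B_n$ is the group of bijections $\sigma$ of $[-n,n]\setminus\{0\}$ with $\sigma(-a)=-\sigma(a)$, written $\sigma=[\sigma(1),\dots,\sigma(n)]$; $neg(\sigma)=|\{i:\sigma(i)<0\}|$ and $D_n=\{\sigma\in B_n: neg(\sigma)\text{ even}\}$. $N$ is the natural order $-n<\dots<-1<1<\dots<n$; $maj_N(\sigma)=\sum\{i\in[1,n-1]:\sigma(i)>\sigma(i+1)\}$; $\text{flag-major}_N(\sigma)=2maj_N(\sigma)+neg(\sigma)$. $\ell(\sigma)$ is the Coxeter length in $B_n$ w.r.t. $s_0=[-1,2,\dots,n]$ and the adjacent transpositions $s_i$; equivalently $\ell(\sigma)=|\{i<j:\sigma(i)>\sigma(j)\}|-\sum_{i:\sigma(i)<0}\sigma(i)$; $sign(\sigma)=(-1)^{\ell(\sigma)}$. Notation: $[k]_x=\frac{1-x^k}{1-x}$, $[n]_{\pm x}!=[1]_x[2]_{ -x}[3]_x\cdots[n]_{(-1)^{n-1}x}$. -}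

module Defs where

open import Data.Bool using (Bool; true; false; not; _∧_; if_then_else_)
open import Data.Nat as ℕ using (ℕ; zero; suc; _/_)
open import Data.Integer as ℤ using (ℤ; +_; -[1+_]; _≤ᵇ_; ∣_∣; _*_; _+_; _-_; _^_; -_)
open import Data.List using (List; []; _∷_; map; _++_; concatMap; upTo; foldr)
open import Data.Bool.ListAction using (any)

-- A signed permutation σ ∈ B_n is represented by its window [σ(1),…,σ(n)],
-- a list of length n of nonzero integers in [-n,n] whose absolute values are distinct.

values : ℕ → List ℤ
values n = map (λ i → -[1+ i ]) (upTo n) ++ map (λ i → + suc i) (upTo n)

words : ℕ → ℕ → List (List ℤ)
words n zero    = [] ∷ []
words n (suc k) = concatMap (λ v → map (v ∷_) (words n k)) (values n)

distinctAbs : List ℤ → Bool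
distinctAbs []       = true
distinctAbs (x ∷ xs) = not (any (λ y → ∣ x ∣ ℕ.≡ᵇ ∣ y ∣) xs) ∧ distinctAbs xs

Bn : ℕ → List (List ℤ)
Bn n = Data.List.filterᵇ distinctAbs (words n n)
  where import Data.List

isNeg : ℤ → Bool
isNeg x = not (+ 0 ≤ᵇ x)

count : (ℤ → Bool) → List ℤ → ℕ
count p []       = 0
count p (x ∷ xs) = (if p x then 1 else 0) ℕ.+ count p xs

neg : List ℤ → ℕ
neg = count isNeg

isEven : ℕ → Bool
isEven zero          = true
isEven (suc zero)    = false
isEven (suc (suc k)) = isEven k

inD : List ℤ → Bool
inD σ = isEven (neg σ)

gt : ℤ → ℤ → Bool
gt x y = not (x ≤ᵇ y)

majFrom : ℕ → List ℤ → ℕ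
majFrom i []           = 0
majFrom i (x ∷ [])     = 0
majFrom i (x ∷ y ∷ xs) = (if gt x y then i else 0) ℕ.+ majFrom (suc i) (y ∷ xs)

majN : List ℤ → ℕ
majN = majFrom 1

flagMajor : List ℤ → ℕ
flagMajor σ = 2 ℕ.* majN σ ℕ.+ neg σ

inv : List ℤ → ℕ
inv []       = 0
inv (x ∷ xs) = count (gt x) xs ℕ.+ inv xs

negSum : List ℤ → ℕ
negSum []       = 0
negSum (x ∷ xs) = (if isNeg x then ∣ x ∣ else 0) ℕ.+ negSum xs

-- Coxeter length ℓ(σ) in B_n
len : List ℤ → ℕ
len σ = inv σ ℕ.+ negSum σ

sign : List ℤ → ℤ
sign σ = (- + 1) ^ len σ

sumℤ : List ℤ → ℤ
sumℤ = foldr _+_ (+ 0)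

lhs : ℕ → ℤ → ℤ
lhs n q = sumℤ (map (λ σ → if inD σ then sign σ * q ^ flagMajor σ else + 0) (Bn n))

qint : ℕ → ℤ → ℤ
qint k x = sumℤ (map (λ j → x ^ j) (upTo k))

qfactPM : ℕ → ℤ → ℤ
qfactPM zero    x = + 1
qfactPM (suc n) x = qfactPM n x * qint (suc n) ((- + 1) ^ n * x)

rhs : ℕ → ℤ → ℤ
rhs n q = (+ 1 - q ^ 2) ^ (n / 2) * qfactPM n (q ^ 2)

-- Read backwards, a window is built by choosing its entries one at a time among the unused
-- absolute values. Group the signed permutations by their sign vector S (which of ±i occur):
-- then sign(σ) q^flag-major(σ) = κ(S) · (-1)^inv(σ) (q²)^maj(σ), where
-- κ(S) = [neg even] (-1)^(sum of |σ(i)| over negative σ(i)) q^neg (signWeight) depends on S alone.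
-- For fixed S the entries are n distinct integers, and the sum of (-1)^inv x^maj over their
-- orderings is [n]_{±x}! (Gessel–Simion): if the last letter is exceeded by c of the other k
-- letters, it adds c inversions and adds k + 1 to maj iff it ends a descent, so summing over c
-- gives a rotated geometric series in ±x. Finally Σ_S (-1)^(Σ S) t^|S| = ∏_{i ≤ n} (1 + (-1)^i t),
-- and averaging t = ±q to keep only even |S| leaves (1 - q²)^⌊n/2⌋.

module Submission where

open import Defs
open import Data.Nat using (ℕ; _≤_)
open import Data.Integer using (ℤ)
open import Relation.Binary.PropositionalEquality using (_≡_)

open import Algebra.Bundles using (CommutativeSemigroup)
open import Algebra.Structures using (IsCommutativeMonoid)
open import Data.Bool using (Bool; true; false; not; _∧_; _∨_; if_then_else_; T)
import Data.Bool.Properties as BP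
open import Data.Bool.ListAction using (any; all)
open import Data.Empty using (⊥-elim)
open import Data.Integer as ℤ using (+_; -[1+_]; -1ℤ; ∣_∣; _+_; _*_; _-_; -_; _^_; _≤ᵇ_)
import Data.Integer.Properties as ℤP
open import Data.Integer.Tactic.RingSolver using (solve-∀)
open import Data.List using (List; []; _∷_; _++_; map; foldr; concatMap; upTo; filterᵇ; reverse; _∷ʳ_; length)
import Data.List.Properties as LP
open import Data.List.Membership.Propositional using (_∈_)
import Data.List.Membership.Propositional.Properties as MP
open import Data.List.Relation.Unary.Any using (here; there)
import Data.List.Relation.Unary.All as All
open import Data.List.Relation.Unary.AllPairs using ([]; _∷_)
open import Data.List.Relation.Unary.Unique.Propositional using (Unique)
import Data.List.Relation.Unary.Unique.Propositional.Properties as UP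
open import Data.Nat as ℕ using (zero; suc; z≤n; s≤s; s≤s⁻¹; _/_)
import Data.Nat.DivMod as ℕDM
import Data.Nat.Properties as ℕP
open import Data.Nat.Tactic.RingSolver using () renaming (solve-∀ to solveℕ)
open import Data.Product using (∃-syntax; _×_; _,_; proj₁; proj₂)
open import Data.Sum using (inj₁; inj₂)
open import Data.Unit using (tt)
open import Function using (_∘_; Equivalence)
open import Level using (0ℓ)
open import Relation.Binary.PropositionalEquality using (_≢_; refl; sym; trans; cong; cong₂; subst; _≗_; module ≡-Reasoning)
open import Relation.Nullary.Decidable using (dec-true; dec-false; T?)

-- Sums over lists

module CommutativeMonoidSum {A : Set} {_∙_ : A → A → A} {ε : A}
                            (isCommutativeMonoid : IsCommutativeMonoid _≡_ _∙_ ε) where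

  open IsCommutativeMonoid isCommutativeMonoid using (assoc; comm; identityˡ; identityʳ; isCommutativeSemigroup)

  private
    commutativeSemigroup : CommutativeSemigroup 0ℓ 0ℓ
    commutativeSemigroup = record { isCommutativeSemigroup = isCommutativeSemigroup }

  open import Algebra.Properties.CommutativeSemigroup commutativeSemigroup using (interchange)
  open ≡-Reasoning

  ∑ : {B : Set} → List B → (B → A) → A
  ∑ xs f = foldr _∙_ ε (map f xs)

  syntax ∑ xs (λ x → e) = ∑[ x ∈ xs ] e

  ∑< : ℕ → (ℕ → A) → A
  ∑< n = ∑ (upTo n)

  syntax ∑< n (λ i → e) = ∑[ i < n ] e

  module _ {B : Set} where

    ∑-++ : (xs ys : List B) (f : B → A) → ∑ (xs ++ ys) f ≡ ∑ xs f ∙ ∑ ys f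
    ∑-++ []       ys f = sym (identityˡ _)
    ∑-++ (x ∷ xs) ys f = trans (cong (f x ∙_) (∑-++ xs ys f)) (sym (assoc (f x) _ _))

    ∑-cong : (xs : List B) {f g : B → A} → f ≗ g → ∑ xs f ≡ ∑ xs g
    ∑-cong []       f≗g = refl
    ∑-cong (x ∷ xs) f≗g = cong₂ _∙_ (f≗g x) (∑-cong xs f≗g)

    ∑-cong-∈ : (xs : List B) {f g : B → A} → (∀ {x} → x ∈ xs → f x ≡ g x) → ∑ xs f ≡ ∑ xs g
    ∑-cong-∈ []       f≡g = refl
    ∑-cong-∈ (x ∷ xs) f≡g = cong₂ _∙_ (f≡g (here refl)) (∑-cong-∈ xs (f≡g ∘ there))

    ∑-ε : (xs : List B) → ∑[ x ∈ xs ] ε ≡ ε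
    ∑-ε []       = refl
    ∑-ε (x ∷ xs) = trans (identityˡ _) (∑-ε xs)

    ∑-if : (xs : List B) (b : Bool) (f : B → A) →
           ∑[ x ∈ xs ] (if b then f x else ε) ≡ (if b then ∑ xs f else ε)
    ∑-if xs true  f = refl
    ∑-if xs false f = ∑-ε xs

    ∑-∙ : (xs : List B) (f g : B → A) → ∑[ x ∈ xs ] (f x ∙ g x) ≡ ∑ xs f ∙ ∑ xs g
    ∑-∙ []       f g = sym (identityˡ ε)
    ∑-∙ (x ∷ xs) f g = begin
      (f x ∙ g x) ∙ (∑[ y ∈ xs ] (f y ∙ g y)) ≡⟨ cong ((f x ∙ g x) ∙_) (∑-∙ xs f g) ⟩
      (f x ∙ g x) ∙ (∑ xs f ∙ ∑ xs g)       ≡⟨ interchange (f x) (g x) (∑ xs f) (∑ xs g) ⟩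
      (f x ∙ ∑ xs f) ∙ (g x ∙ ∑ xs g)       ∎

    ∑-filter : (p : B → Bool) (xs : List B) (f : B → A) →
               ∑ (filterᵇ p xs) f ≡ ∑[ x ∈ xs ] (if p x then f x else ε)
    ∑-filter p []       f = refl
    ∑-filter p (x ∷ xs) f with p x
    ... | true  = cong (f x ∙_) (∑-filter p xs f)
    ... | false = trans (∑-filter p xs f) (sym (identityˡ _))

    ∑-reverse : (xs : List B) (f : B → A) → ∑ (reverse xs) f ≡ ∑ xs f
    ∑-reverse []       f = refl
    ∑-reverse (x ∷ xs) f = begin
      ∑ (reverse (x ∷ xs)) f   ≡⟨ cong (λ l → ∑ l f) (LP.unfold-reverse x xs) ⟩
      ∑ (reverse xs ∷ʳ x) f    ≡⟨ ∑-++ (reverse xs) (x ∷ []) f ⟩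
      ∑ (reverse xs) f ∙ (f x ∙ ε) ≡⟨ cong₂ _∙_ (∑-reverse xs f) (identityʳ (f x)) ⟩
      ∑ xs f ∙ f x             ≡⟨ comm (∑ xs f) (f x) ⟩
      f x ∙ ∑ xs f             ∎

  module _ {B C : Set} where

    ∑-map : (g : B → C) (xs : List B) (f : C → A) → ∑ (map g xs) f ≡ ∑ xs (f ∘ g)
    ∑-map g []       f = refl
    ∑-map g (x ∷ xs) f = cong (f (g x) ∙_) (∑-map g xs f)

    ∑-concatMap : (h : B → List C) (xs : List B) (f : C → A) →
                  ∑ (concatMap h xs) f ≡ ∑[ x ∈ xs ] ∑ (h x) f
    ∑-concatMap h []       f = refl
    ∑-concatMap h (x ∷ xs) f =
      trans (∑-++ (h x) (concatMap h xs) f) (cong (∑ (h x) f ∙_) (∑-concatMap h xs f))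

    ∑-map-filterᵇ : (g : B → C) (p : B → Bool) (xs : List B) (f : C → A) →
                    ∑ (map g (filterᵇ p xs)) f ≡ ∑[ x ∈ xs ] (if p x then f (g x) else ε)
    ∑-map-filterᵇ g p xs f = trans (∑-map g (filterᵇ p xs) f) (∑-filter p xs (f ∘ g))

    ∑-comm : (xs : List B) (ys : List C) (f : B → C → A) →
             ∑[ x ∈ xs ] ∑[ y ∈ ys ] f x y ≡ ∑[ y ∈ ys ] ∑[ x ∈ xs ] f x y
    ∑-comm []       ys f = sym (∑-ε ys)
    ∑-comm (x ∷ xs) ys f =
      trans (cong (∑ ys (f x) ∙_) (∑-comm xs ys f)) (sym (∑-∙ ys (f x) (λ y → ∑[ x′ ∈ xs ] f x′ y)))

  ∑<-suc : ∀ n (f : ℕ → A) → ∑< (suc n) f ≡ ∑< n f ∙ f n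
  ∑<-suc n f = begin
    ∑ (upTo (suc n)) f        ≡⟨ cong (λ l → ∑ l f) (sym (LP.upTo-∷ʳ n)) ⟩
    ∑ (upTo n ∷ʳ n) f         ≡⟨ ∑-++ (upTo n) (n ∷ []) f ⟩
    ∑< n f ∙ (f n ∙ ε)        ≡⟨ cong (∑< n f ∙_) (identityʳ (f n)) ⟩
    ∑< n f ∙ f n              ∎

  ∑<-suc-front : ∀ n (f : ℕ → A) → ∑< (suc n) f ≡ f 0 ∙ ∑< n (f ∘ suc)
  ∑<-suc-front n f = cong (λ l → f 0 ∙ foldr _∙_ ε l)
    (trans (LP.map-applyUpTo suc f n) (sym (LP.map-upTo (f ∘ suc) n)))

  ∑<-cong : ∀ n {f g : ℕ → A} → (∀ {i} → i ℕ.< n → f i ≡ g i) → ∑< n f ≡ ∑< n g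
  ∑<-cong n f≡g = ∑-cong-∈ (upTo n) (f≡g ∘ MP.∈-upTo⁻)

  ∑<-pick : ∀ n {i} → i ℕ.< n → (g : ℕ → A) →
            ∑< n g ≡ g i ∙ (∑[ j < n ] (if j ℕ.≡ᵇ i then ε else g j))
  ∑<-pick (suc n) {i} i<1+n g with ℕP.m≤n⇒m<n∨m≡n (s≤s⁻¹ i<1+n)
  ... | inj₁ i<n = begin
    ∑< (suc n) g                ≡⟨ ∑<-suc n g ⟩
    ∑< n g ∙ g n                ≡⟨ cong (_∙ g n) (∑<-pick n i<n g) ⟩
    (g i ∙ ∑< n g′) ∙ g n       ≡⟨ assoc (g i) _ _ ⟩
    g i ∙ (∑< n g′ ∙ g n)       ≡⟨ cong (λ t → g i ∙ (∑< n g′ ∙ t)) (sym (g′≡g (ℕP.<⇒≢ i<n ∘ sym))) ⟩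
    g i ∙ (∑< n g′ ∙ g′ n)      ≡⟨ cong (g i ∙_) (sym (∑<-suc n g′)) ⟩
    g i ∙ ∑< (suc n) g′         ∎
    where
    g′ = λ j → if j ℕ.≡ᵇ i then ε else g j
    g′≡g : ∀ {j} → j ≢ i → g′ j ≡ g j
    g′≡g {j} j≢i rewrite dec-false (j ℕP.≟ i) j≢i = refl
  ... | inj₂ refl = begin
    ∑< (suc n) g                ≡⟨ ∑<-suc n g ⟩
    ∑< n g ∙ g n                ≡⟨ comm (∑< n g) (g n) ⟩
    g n ∙ ∑< n g                ≡⟨ cong (g n ∙_) (∑<-cong n (λ j<n → sym (g′≡g (ℕP.<⇒≢ j<n)))) ⟩
    g n ∙ ∑< n g′               ≡⟨ cong (g n ∙_) (sym (identityʳ _)) ⟩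
    g n ∙ (∑< n g′ ∙ ε)         ≡⟨ cong (λ t → g n ∙ (∑< n g′ ∙ (if t then ε else g n)))
                                        (sym (dec-true (n ℕP.≟ n) refl)) ⟩
    g n ∙ (∑< n g′ ∙ g′ n)      ≡⟨ cong (g n ∙_) (sym (∑<-suc n g′)) ⟩
    g n ∙ ∑< (suc n) g′         ∎
    where
    g′ = λ j → if j ℕ.≡ᵇ n then ε else g j
    g′≡g : ∀ {j} → j ≢ n → g′ j ≡ g j
    g′≡g {j} j≢n rewrite dec-false (j ℕP.≟ n) j≢n = refl

open CommutativeMonoidSum ℤP.+-0-isCommutativeMonoid
module ℕΣ = CommutativeMonoidSum ℕP.+-0-isCommutativeMonoid

∑-*ˡ : ∀ {B : Set} (xs : List B) (c : ℤ) (f : B → ℤ) → ∑[ x ∈ xs ] (c * f x) ≡ c * ∑ xs f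
∑-*ˡ []       c f = sym (ℤP.*-zeroʳ c)
∑-*ˡ (x ∷ xs) c f = trans (cong (_+_ (c * f x)) (∑-*ˡ xs c f)) (sym (ℤP.*-distribˡ-+ c (f x) _))

∑-*ʳ : ∀ {B : Set} (xs : List B) (f : B → ℤ) (c : ℤ) → ∑[ x ∈ xs ] (f x * c) ≡ ∑ xs f * c
∑-*ʳ xs f c = trans (∑-cong xs (λ x → ℤP.*-comm (f x) c)) (trans (∑-*ˡ xs c f) (ℤP.*-comm c (∑ xs f)))

-- Windows read backwards

∑-words-suc : ∀ n k (G : List ℤ → ℤ) →
              ∑ (words n (suc k)) G ≡ ∑[ v ∈ values n ] ∑[ w ∈ words n k ] G (v ∷ w)
∑-words-suc n k G = trans (∑-concatMap (λ v → map (v ∷_) (words n k)) (values n) G)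
                          (∑-cong (values n) (λ v → ∑-map (v ∷_) (words n k) G))

∑-words-∷ʳ : ∀ n k (G : List ℤ → ℤ) →
             ∑ (words n (suc k)) G ≡ ∑[ w ∈ words n k ] ∑[ v ∈ values n ] G (w ∷ʳ v)
∑-words-∷ʳ n zero    G = trans (∑-words-suc n 0 G)
  (trans (∑-cong (values n) (λ v → ℤP.+-identityʳ (G (v ∷ [])))) (sym (ℤP.+-identityʳ _)))
∑-words-∷ʳ n (suc k) G = begin
  ∑ (words n (suc (suc k))) G
    ≡⟨ ∑-words-suc n (suc k) G ⟩
  ∑[ u ∈ values n ] ∑ (words n (suc k)) (G ∘ (u ∷_))
    ≡⟨ ∑-cong (values n) (λ u → ∑-words-∷ʳ n k (G ∘ (u ∷_))) ⟩
  ∑[ u ∈ values n ] ∑[ w ∈ words n k ] ∑[ v ∈ values n ] G (u ∷ w ∷ʳ v)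
    ≡⟨ sym (∑-words-suc n k _) ⟩
  ∑[ w ∈ words n (suc k) ] ∑[ v ∈ values n ] G (w ∷ʳ v) ∎
  where open ≡-Reasoning

∑-words-reverse : ∀ n k (G : List ℤ → ℤ) → ∑ (words n k) G ≡ ∑ (words n k) (G ∘ reverse)
∑-words-reverse n zero    G = refl
∑-words-reverse n (suc k) G = sym (begin
  ∑ (words n (suc k)) (G ∘ reverse)
    ≡⟨ ∑-words-∷ʳ n k (G ∘ reverse) ⟩
  ∑[ w ∈ words n k ] ∑[ v ∈ values n ] G (reverse (w ∷ʳ v))
    ≡⟨ ∑-cong (words n k) (λ w → ∑-cong (values n) (λ v → cong G (LP.reverse-++ w (v ∷ [])))) ⟩
  ∑[ w ∈ words n k ] H (reverse w)
    ≡⟨ sym (∑-words-reverse n k H) ⟩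
  ∑ (words n k) H
    ≡⟨ ∑-comm (words n k) (values n) (λ w v → G (v ∷ w)) ⟩
  ∑[ v ∈ values n ] ∑[ w ∈ words n k ] G (v ∷ w)
    ≡⟨ sym (∑-words-suc n k G) ⟩
  ∑ (words n (suc k)) G ∎)
  where
  open ≡-Reasoning
  H : List ℤ → ℤ
  H u = ∑[ v ∈ values n ] G (v ∷ u)

≡ᵇ-sym : ∀ m n → (m ℕ.≡ᵇ n) ≡ (n ℕ.≡ᵇ m)
≡ᵇ-sym zero    zero    = refl
≡ᵇ-sym zero    (suc n) = refl
≡ᵇ-sym (suc m) zero    = refl
≡ᵇ-sym (suc m) (suc n) = ≡ᵇ-sym m n

any-∷ʳ : ∀ {A : Set} (p : A → Bool) xs a → any p (xs ∷ʳ a) ≡ any p xs ∨ p a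
any-∷ʳ p []       a = BP.∨-identityʳ (p a)
any-∷ʳ p (x ∷ xs) a = trans (cong (p x ∨_) (any-∷ʳ p xs a)) (sym (BP.∨-assoc (p x) _ _))

any-reverse : ∀ {A : Set} (p : A → Bool) xs → any p (reverse xs) ≡ any p xs
any-reverse p []       = refl
any-reverse p (x ∷ xs) = begin
  any p (reverse (x ∷ xs))   ≡⟨ cong (any p) (LP.unfold-reverse x xs) ⟩
  any p (reverse xs ∷ʳ x)    ≡⟨ any-∷ʳ p (reverse xs) x ⟩
  any p (reverse xs) ∨ p x   ≡⟨ cong (_∨ p x) (any-reverse p xs) ⟩
  any p xs ∨ p x             ≡⟨ BP.∨-comm (any p xs) (p x) ⟩
  p x ∨ any p xs             ∎
  where open ≡-Reasoning

distinctAbs-∷ʳ : ∀ xs a → distinctAbs (xs ∷ʳ a) ≡ not (any (λ y → ∣ a ∣ ℕ.≡ᵇ ∣ y ∣) xs) ∧ distinctAbs xs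
distinctAbs-∷ʳ []       a = refl
distinctAbs-∷ʳ (x ∷ xs) a = begin
  not (any ≡x (xs ∷ʳ a)) ∧ distinctAbs (xs ∷ʳ a)
    ≡⟨ cong₂ (λ u v → not u ∧ v) (any-∷ʳ ≡x xs a) (distinctAbs-∷ʳ xs a) ⟩
  not (any ≡x xs ∨ (∣ x ∣ ℕ.≡ᵇ ∣ a ∣)) ∧ (not (any ≡a xs) ∧ distinctAbs xs)
    ≡⟨ swap (any ≡x xs) (∣ x ∣ ℕ.≡ᵇ ∣ a ∣) (any ≡a xs) (distinctAbs xs) ⟩
  not ((∣ x ∣ ℕ.≡ᵇ ∣ a ∣) ∨ any ≡a xs) ∧ (not (any ≡x xs) ∧ distinctAbs xs)
    ≡⟨ cong (λ e → not (e ∨ any ≡a xs) ∧ (not (any ≡x xs) ∧ distinctAbs xs)) (≡ᵇ-sym ∣ x ∣ ∣ a ∣) ⟩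
  not ((∣ a ∣ ℕ.≡ᵇ ∣ x ∣) ∨ any ≡a xs) ∧ (not (any ≡x xs) ∧ distinctAbs xs) ∎
  where
  open ≡-Reasoning
  ≡x = λ y → ∣ x ∣ ℕ.≡ᵇ ∣ y ∣
  ≡a = λ y → ∣ a ∣ ℕ.≡ᵇ ∣ y ∣
  swap : ∀ b e c d → not (b ∨ e) ∧ (not c ∧ d) ≡ not (e ∨ c) ∧ (not b ∧ d)
  swap true  e     c d = sym (BP.∧-zeroʳ _)
  swap false true  c d = refl
  swap false false c d = refl

distinctAbs-reverse : ∀ w → distinctAbs (reverse w) ≡ distinctAbs w
distinctAbs-reverse []      = refl
distinctAbs-reverse (a ∷ w) = begin
  distinctAbs (reverse (a ∷ w))  ≡⟨ cong distinctAbs (LP.unfold-reverse a w) ⟩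
  distinctAbs (reverse w ∷ʳ a)   ≡⟨ distinctAbs-∷ʳ (reverse w) a ⟩
  not (any ≡a (reverse w)) ∧ distinctAbs (reverse w)
    ≡⟨ cong₂ (λ u v → not u ∧ v) (any-reverse ≡a w) (distinctAbs-reverse w) ⟩
  not (any ≡a w) ∧ distinctAbs w ∎
  where
  open ≡-Reasoning
  ≡a = λ y → ∣ a ∣ ℕ.≡ᵇ ∣ y ∣

lhsTerm : ℤ → List ℤ → ℤ
lhsTerm q σ = if inD σ then sign σ * q ^ flagMajor σ else + 0

lhs-reversed : ∀ n q → lhs n q ≡ ∑[ w ∈ words n n ] (if distinctAbs w then lhsTerm q (reverse w) else + 0)
lhs-reversed n q = begin
  lhs n q
    ≡⟨ ∑-filter distinctAbs (words n n) (lhsTerm q) ⟩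
  ∑[ w ∈ words n n ] (if distinctAbs w then lhsTerm q w else + 0)
    ≡⟨ ∑-words-reverse n n _ ⟩
  ∑[ w ∈ words n n ] (if distinctAbs (reverse w) then lhsTerm q (reverse w) else + 0)
    ≡⟨ ∑-cong (words n n) (λ w → cong (λ b → if b then lhsTerm q (reverse w) else + 0) (distinctAbs-reverse w)) ⟩
  ∑[ w ∈ words n n ] (if distinctAbs w then lhsTerm q (reverse w) else + 0) ∎
  where open ≡-Reasoning

-- Signed permutations grouped by sign vector

_∉ᵇ_ : ℕ → List ℕ → Bool
r ∉ᵇ U = all (λ u → not (r ℕ.≡ᵇ u)) U

avoids : List ℕ → List ℤ → Bool
avoids U = all (λ y → ∣ y ∣ ∉ᵇ U)

avoids-[] : ∀ w → avoids [] w ≡ true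
avoids-[] []      = refl
avoids-[] (y ∷ w) = avoids-[] w

avoids-∷ : ∀ r U w → avoids (r ∷ U) w ≡ not (any (λ y → r ℕ.≡ᵇ ∣ y ∣) w) ∧ avoids U w
avoids-∷ r U []      = refl
avoids-∷ r U (y ∷ w) = begin
  (not (∣ y ∣ ℕ.≡ᵇ r) ∧ (∣ y ∣ ∉ᵇ U)) ∧ avoids (r ∷ U) w
    ≡⟨ cong (λ t → (not t ∧ (∣ y ∣ ∉ᵇ U)) ∧ avoids (r ∷ U) w) (≡ᵇ-sym ∣ y ∣ r) ⟩
  (not (r ℕ.≡ᵇ ∣ y ∣) ∧ (∣ y ∣ ∉ᵇ U)) ∧ avoids (r ∷ U) w
    ≡⟨ cong ((not (r ℕ.≡ᵇ ∣ y ∣) ∧ (∣ y ∣ ∉ᵇ U)) ∧_) (avoids-∷ r U w) ⟩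
  (not (r ℕ.≡ᵇ ∣ y ∣) ∧ (∣ y ∣ ∉ᵇ U)) ∧ (not (any ≡r w) ∧ avoids U w)
    ≡⟨ regroup (r ℕ.≡ᵇ ∣ y ∣) (∣ y ∣ ∉ᵇ U) (any ≡r w) (avoids U w) ⟩
  not ((r ℕ.≡ᵇ ∣ y ∣) ∨ any ≡r w) ∧ ((∣ y ∣ ∉ᵇ U) ∧ avoids U w) ∎
  where
  open ≡-Reasoning
  ≡r = λ y → r ℕ.≡ᵇ ∣ y ∣
  regroup : ∀ e b c d → (not e ∧ b) ∧ (not c ∧ d) ≡ not (e ∨ c) ∧ (b ∧ d)
  regroup true  b     c d = refl
  regroup false true  c d = refl
  regroup false false c d = sym (BP.∧-zeroʳ _)

distinct-avoids-∷ : ∀ U v w → distinctAbs (v ∷ w) ∧ avoids U (v ∷ w)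
                              ≡ (∣ v ∣ ∉ᵇ U) ∧ (distinctAbs w ∧ avoids (∣ v ∣ ∷ U) w)
distinct-avoids-∷ U v w = trans
  (regroup (any (λ y → ∣ v ∣ ℕ.≡ᵇ ∣ y ∣) w) (distinctAbs w) (∣ v ∣ ∉ᵇ U) (avoids U w))
  (cong (λ t → (∣ v ∣ ∉ᵇ U) ∧ (distinctAbs w ∧ t)) (sym (avoids-∷ ∣ v ∣ U w)))
  where
  regroup : ∀ c d b a → (not c ∧ d) ∧ (b ∧ a) ≡ b ∧ (d ∧ (not c ∧ a))
  regroup c d false a = BP.∧-zeroʳ _
  regroup true  true  true a = refl
  regroup true  false true a = refl
  regroup false true  true a = refl
  regroup false false true a = refl

distinctWordSum : ℕ → List ℕ → ℕ → (List ℤ → ℤ) → ℤ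
distinctWordSum n U k G = ∑[ w ∈ words n k ] (if distinctAbs w ∧ avoids U w then G w else + 0)

∑-values : ∀ n (h : ℤ → ℤ) → ∑ (values n) h ≡ ∑[ i < n ] (h -[1+ i ] + h (+ suc i))
∑-values n h = begin
  ∑ (values n) h
    ≡⟨ ∑-++ (map -[1+_] (upTo n)) (map (λ i → + suc i) (upTo n)) h ⟩
  ∑ (map -[1+_] (upTo n)) h + ∑ (map (λ i → + suc i) (upTo n)) h
    ≡⟨ cong₂ _+_ (∑-map -[1+_] (upTo n) h) (∑-map (λ i → + suc i) (upTo n) h) ⟩
  ∑[ i < n ] h -[1+ i ] + ∑[ i < n ] h (+ suc i)
    ≡⟨ sym (∑-∙ (upTo n) (λ i → h -[1+ i ]) (λ i → h (+ suc i))) ⟩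
  ∑[ i < n ] (h -[1+ i ] + h (+ suc i)) ∎
  where open ≡-Reasoning

distinctWordSum-suc : ∀ n U k (G : List ℤ → ℤ) → distinctWordSum n U (suc k) G ≡
  ∑[ i < n ] (if suc i ∉ᵇ U
              then distinctWordSum n (suc i ∷ U) k (G ∘ (-[1+ i ] ∷_)) + distinctWordSum n (suc i ∷ U) k (G ∘ (+ suc i ∷_))
              else + 0)
distinctWordSum-suc n U k G = begin
  distinctWordSum n U (suc k) G
    ≡⟨ ∑-words-suc n k _ ⟩
  ∑[ v ∈ values n ] ∑[ w ∈ words n k ] (if distinctAbs (v ∷ w) ∧ avoids U (v ∷ w) then G (v ∷ w) else + 0)
    ≡⟨ ∑-cong (values n) (λ v → trans (∑-cong (words n k) (split v)) (∑-if (words n k) (∣ v ∣ ∉ᵇ U) _)) ⟩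
  ∑ (values n) h
    ≡⟨ ∑-values n h ⟩
  ∑[ i < n ] (h -[1+ i ] + h (+ suc i))
    ≡⟨ ∑<-cong n (λ {i} _ → if-+ (suc i ∉ᵇ U) _ _) ⟩
  _ ∎
  where
  open ≡-Reasoning
  h : ℤ → ℤ
  h v = if ∣ v ∣ ∉ᵇ U then distinctWordSum n (∣ v ∣ ∷ U) k (G ∘ (v ∷_)) else + 0
  split : ∀ v w → (if distinctAbs (v ∷ w) ∧ avoids U (v ∷ w) then G (v ∷ w) else + 0)
                ≡ (if ∣ v ∣ ∉ᵇ U then (if distinctAbs w ∧ avoids (∣ v ∣ ∷ U) w then G (v ∷ w) else + 0) else + 0)
  split v w rewrite distinct-avoids-∷ U v w with ∣ v ∣ ∉ᵇ U
  ... | true  = refl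
  ... | false = refl
  if-+ : ∀ b (x y : ℤ) → (if b then x else + 0) + (if b then y else + 0) ≡ (if b then x + y else + 0)
  if-+ true  x y = refl
  if-+ false x y = refl

signVectors : ℕ → List (List Bool)
signVectors zero    = [] ∷ []
signVectors (suc n) = map (false ∷_) (signVectors n) ++ map (true ∷_) (signVectors n)

∑-signVectors-suc : ∀ n (Φ : List Bool → ℤ) →
  ∑ (signVectors (suc n)) Φ ≡ ∑[ S ∈ signVectors n ] Φ (false ∷ S) + ∑[ S ∈ signVectors n ] Φ (true ∷ S)
∑-signVectors-suc n Φ = trans (∑-++ (map (false ∷_) (signVectors n)) (map (true ∷_) (signVectors n)) Φ)
  (cong₂ _+_ (∑-map (false ∷_) (signVectors n) Φ) (∑-map (true ∷_) (signVectors n) Φ))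

∑-signVectors-const : ∀ n (c : ℤ) → ∑[ S ∈ signVectors n ] c ≡ (+ 2) ^ n * c
∑-signVectors-const zero    c = trans (ℤP.+-identityʳ c) (sym (ℤP.*-identityˡ c))
∑-signVectors-const (suc n) c = begin
  ∑[ S ∈ signVectors (suc n) ] c               ≡⟨ ∑-signVectors-suc n (λ _ → c) ⟩
  ∑[ S ∈ signVectors n ] c + ∑[ S ∈ signVectors n ] c
                                               ≡⟨ cong (λ t → t + t) (∑-signVectors-const n c) ⟩
  (+ 2) ^ n * c + (+ 2) ^ n * c                ≡⟨ double ((+ 2) ^ n) c ⟩
  (+ 2) ^ suc n * c                            ∎
  where
  open ≡-Reasoning
  double : ∀ a c → a * c + a * c ≡ (+ 2 * a) * c
  double = solve-∀

signAt : List Bool → ℕ → Bool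
signAt []      i       = false
signAt (s ∷ S) zero    = s
signAt (s ∷ S) (suc i) = signAt S i

setSign : ℕ → Bool → List Bool → List Bool
setSign i       b []      = []
setSign zero    b (s ∷ S) = b ∷ S
setSign (suc i) b (s ∷ S) = s ∷ setSign i b S

signAt-setSign : ∀ {i j} b S → j ≢ i → signAt (setSign i b S) j ≡ signAt S j
signAt-setSign {i}     {j}     b []      j≢i = refl
signAt-setSign {zero}  {zero}  b (s ∷ S) j≢i = ⊥-elim (j≢i refl)
signAt-setSign {zero}  {suc j} b (s ∷ S) j≢i = refl
signAt-setSign {suc i} {zero}  b (s ∷ S) j≢i = refl
signAt-setSign {suc i} {suc j} b (s ∷ S) j≢i = signAt-setSign b S (j≢i ∘ cong suc)

∑-signVectors-signAt : ∀ n {i} → i ℕ.< n → (Φ : List Bool → Bool → ℤ) →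
  (∀ S b → Φ (setSign i true S) b ≡ Φ (setSign i false S) b) →
  + 2 * ∑[ S ∈ signVectors n ] Φ S (signAt S i) ≡ ∑[ S ∈ signVectors n ] (Φ S true + Φ S false)
∑-signVectors-signAt (suc n) {zero} _ Φ Φ-ignores-0 = begin
  + 2 * ∑[ S ∈ signVectors (suc n) ] Φ S (signAt S 0)
    ≡⟨ cong (+ 2 *_) (∑-signVectors-suc n _) ⟩
  + 2 * (A + ∑[ S ∈ signVectors n ] Φ (true ∷ S) true)
    ≡⟨ cong (λ t → + 2 * (A + t)) (∑-cong (signVectors n) (λ S → Φ-ignores-0 (false ∷ S) true)) ⟩
  + 2 * (A + B)
    ≡⟨ double A B ⟩
  (B + A) + (B + A)
    ≡⟨ cong₂ _+_ (sym (∑-∙ (signVectors n) _ _))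
                 (trans (cong₂ _+_ (∑-cong (signVectors n) (λ S → sym (Φ-ignores-0 (false ∷ S) true)))
                                   (∑-cong (signVectors n) (λ S → sym (Φ-ignores-0 (false ∷ S) false))))
                        (sym (∑-∙ (signVectors n) _ _))) ⟩
  ∑[ S ∈ signVectors n ] (Φ (false ∷ S) true + Φ (false ∷ S) false)
    + ∑[ S ∈ signVectors n ] (Φ (true ∷ S) true + Φ (true ∷ S) false)
    ≡⟨ sym (∑-signVectors-suc n _) ⟩
  ∑[ S ∈ signVectors (suc n) ] (Φ S true + Φ S false) ∎
  where
  open ≡-Reasoning
  A = ∑[ S ∈ signVectors n ] Φ (false ∷ S) false
  B = ∑[ S ∈ signVectors n ] Φ (false ∷ S) true
  double : ∀ a b → + 2 * (a + b) ≡ (b + a) + (b + a)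
  double = solve-∀
∑-signVectors-signAt (suc n) {suc i} (s≤s i<n) Φ Φ-ignores-i = begin
  + 2 * ∑[ S ∈ signVectors (suc n) ] Φ S (signAt S (suc i))
    ≡⟨ cong (+ 2 *_) (∑-signVectors-suc n _) ⟩
  + 2 * (X false + X true)
    ≡⟨ ℤP.*-distribˡ-+ (+ 2) (X false) (X true) ⟩
  + 2 * X false + + 2 * X true
    ≡⟨ cong₂ _+_ (∑-signVectors-signAt n i<n (Φ ∘ (false ∷_)) (Φ-ignores-i ∘ (false ∷_)))
                 (∑-signVectors-signAt n i<n (Φ ∘ (true ∷_)) (Φ-ignores-i ∘ (true ∷_))) ⟩
  _ ≡⟨ sym (∑-signVectors-suc n _) ⟩
  ∑[ S ∈ signVectors (suc n) ] (Φ S true + Φ S false) ∎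
  where
  open ≡-Reasoning
  X : Bool → ℤ
  X s = ∑[ S ∈ signVectors n ] Φ (s ∷ S) (signAt S i)

∉ᵇ-∷⁻ : ∀ r u U → (r ∉ᵇ (u ∷ U)) ≡ true → r ≢ u × (r ∉ᵇ U) ≡ true
∉ᵇ-∷⁻ r u U fresh with r ℕ.≡ᵇ u in r≡ᵇu
... | false = (λ r≡u → subst T r≡ᵇu (ℕP.≡⇒≡ᵇ r u r≡u)) , fresh

-- Index i stands for the absolute value i + 1.
signed : Bool → ℕ → ℤ
signed true  i = -[1+ i ]
signed false i = + suc i

entry : List Bool → ℕ → ℤ
entry S i = signed (signAt S i) i

arrangementSum : ℕ → List Bool → List ℕ → ℕ → (List ℤ → ℤ) → ℤ
arrangementSum n S U zero    G = G []
arrangementSum n S U (suc k) G =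
  ∑[ i < n ] (if suc i ∉ᵇ U then arrangementSum n S (suc i ∷ U) k (G ∘ (entry S i ∷_)) else + 0)

arrangementSum-cong-signs : ∀ n {S S′} U k (G : List ℤ → ℤ) →
                            (∀ j → (suc j ∉ᵇ U) ≡ true → signAt S j ≡ signAt S′ j) →
                            arrangementSum n S U k G ≡ arrangementSum n S′ U k G
arrangementSum-cong-signs n U zero    G same = refl
arrangementSum-cong-signs n {S} {S′} U (suc k) G same = ∑<-cong n (λ {i} _ → step i)
  where
  step : ∀ i → (if suc i ∉ᵇ U then arrangementSum n S (suc i ∷ U) k (G ∘ (entry S i ∷_)) else + 0)
             ≡ (if suc i ∉ᵇ U then arrangementSum n S′ (suc i ∷ U) k (G ∘ (entry S′ i ∷_)) else + 0)
  step i with suc i ∉ᵇ U in fresh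
  ... | false = refl
  ... | true  = trans (cong (λ b → arrangementSum n S (suc i ∷ U) k (G ∘ (signed b i ∷_))) (same i fresh))
                      (arrangementSum-cong-signs n (suc i ∷ U) k _ (λ j → same j ∘ proj₂ ∘ ∉ᵇ-∷⁻ (suc j) (suc i) U))

∑-signVectors-firstEntry : ∀ n U k (G : List ℤ → ℤ) {i} → i ℕ.< n →
  + 2 * ∑[ S ∈ signVectors n ] (if suc i ∉ᵇ U then arrangementSum n S (suc i ∷ U) k (G ∘ (entry S i ∷_)) else + 0)
  ≡ (if suc i ∉ᵇ U
     then ∑[ S ∈ signVectors n ] arrangementSum n S (suc i ∷ U) k (G ∘ (-[1+ i ] ∷_))
          + ∑[ S ∈ signVectors n ] arrangementSum n S (suc i ∷ U) k (G ∘ (+ suc i ∷_))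
     else + 0)
∑-signVectors-firstEntry n U k G {i} i<n with suc i ∉ᵇ U
... | false = trans (cong (+ 2 *_) (∑-ε (signVectors n))) (ℤP.*-zeroʳ (+ 2))
... | true  = trans (∑-signVectors-signAt n i<n Φ Φ-ignores-i) (∑-∙ (signVectors n) (λ S → Φ S true) (λ S → Φ S false))
  where
  Φ : List Bool → Bool → ℤ
  Φ S b = arrangementSum n S (suc i ∷ U) k (G ∘ (signed b i ∷_))
  Φ-ignores-i : ∀ S b → Φ (setSign i true S) b ≡ Φ (setSign i false S) b
  Φ-ignores-i S b = arrangementSum-cong-signs n (suc i ∷ U) k _ (λ j fresh →
    let j≢i = proj₁ (∉ᵇ-∷⁻ (suc j) (suc i) U fresh) ∘ cong suc
    in trans (signAt-setSign true S j≢i) (sym (signAt-setSign false S j≢i)))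

-- Summing over all sign vectors counts every word 2 ^ (n - k) times.
∑-signVectors-arrangementSum : ∀ n U k (G : List ℤ → ℤ) →
  (+ 2) ^ k * ∑[ S ∈ signVectors n ] arrangementSum n S U k G ≡ (+ 2) ^ n * distinctWordSum n U k G
∑-signVectors-arrangementSum n U zero G =
  trans (ℤP.*-identityˡ _) (trans (∑-signVectors-const n (G [])) (cong ((+ 2) ^ n *_) (sym (ℤP.+-identityʳ (G [])))))
∑-signVectors-arrangementSum n U (suc k) G = begin
  (+ 2 * (+ 2) ^ k) * ∑[ S ∈ signVectors n ] ∑[ i < n ] branch i S
    ≡⟨ cong ((+ 2 * (+ 2) ^ k) *_) (∑-comm (signVectors n) (upTo n) (λ S i → branch i S)) ⟩
  (+ 2 * (+ 2) ^ k) * ∑[ i < n ] ∑[ S ∈ signVectors n ] branch i S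
    ≡⟨ sym (∑-*ˡ (upTo n) (+ 2 * (+ 2) ^ k) _) ⟩
  ∑[ i < n ] ((+ 2 * (+ 2) ^ k) * ∑[ S ∈ signVectors n ] branch i S)
    ≡⟨ ∑<-cong n (λ {i} i<n → trans (swap-2 (∑[ S ∈ signVectors n ] branch i S))
                                   (cong ((+ 2) ^ k *_) (∑-signVectors-firstEntry n U k G i<n))) ⟩
  ∑[ i < n ] ((+ 2) ^ k * (if suc i ∉ᵇ U then ∑P (-[1+ i ]) i + ∑P (+ suc i) i else + 0))
    ≡⟨ ∑<-cong n (λ {i} _ → by-induction i (suc i ∉ᵇ U)) ⟩
  ∑[ i < n ] ((+ 2) ^ n * (if suc i ∉ᵇ U then W (-[1+ i ]) i + W (+ suc i) i else + 0))
    ≡⟨ ∑-*ˡ (upTo n) ((+ 2) ^ n) _ ⟩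
  (+ 2) ^ n * ∑[ i < n ] (if suc i ∉ᵇ U then W (-[1+ i ]) i + W (+ suc i) i else + 0)
    ≡⟨ cong ((+ 2) ^ n *_) (sym (distinctWordSum-suc n U k G)) ⟩
  (+ 2) ^ n * distinctWordSum n U (suc k) G ∎
  where
  open ≡-Reasoning
  branch : ℕ → List Bool → ℤ
  branch i S = if suc i ∉ᵇ U then arrangementSum n S (suc i ∷ U) k (G ∘ (entry S i ∷_)) else + 0
  ∑P W : ℤ → ℕ → ℤ
  ∑P v i = ∑[ S ∈ signVectors n ] arrangementSum n S (suc i ∷ U) k (G ∘ (v ∷_))
  W  v i = distinctWordSum n (suc i ∷ U) k (G ∘ (v ∷_))

  swap-2 : ∀ s → (+ 2 * (+ 2) ^ k) * s ≡ (+ 2) ^ k * (+ 2 * s)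
  swap-2 s = trans (ℤP.*-assoc (+ 2) ((+ 2) ^ k) s) (x∙yz≈y∙xz (+ 2) ((+ 2) ^ k) s)
    where
    x∙yz≈y∙xz : ∀ a b c → a * (b * c) ≡ b * (a * c)
    x∙yz≈y∙xz = solve-∀

  by-induction : ∀ i b → (+ 2) ^ k * (if b then ∑P (-[1+ i ]) i + ∑P (+ suc i) i else + 0)
                       ≡ (+ 2) ^ n * (if b then W (-[1+ i ]) i + W (+ suc i) i else + 0)
  by-induction i false = trans (ℤP.*-zeroʳ ((+ 2) ^ k)) (sym (ℤP.*-zeroʳ ((+ 2) ^ n)))
  by-induction i true  = begin
    (+ 2) ^ k * (∑P (-[1+ i ]) i + ∑P (+ suc i) i)
      ≡⟨ ℤP.*-distribˡ-+ ((+ 2) ^ k) _ _ ⟩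
    (+ 2) ^ k * ∑P (-[1+ i ]) i + (+ 2) ^ k * ∑P (+ suc i) i
      ≡⟨ cong₂ _+_ (∑-signVectors-arrangementSum n (suc i ∷ U) k (G ∘ (-[1+ i ] ∷_)))
                   (∑-signVectors-arrangementSum n (suc i ∷ U) k (G ∘ (+ suc i ∷_))) ⟩
    (+ 2) ^ n * W (-[1+ i ]) i + (+ 2) ^ n * W (+ suc i) i
      ≡⟨ ℤP.*-distribˡ-+ ((+ 2) ^ n) _ _ ⟨
    (+ 2) ^ n * (W (-[1+ i ]) i + W (+ suc i) i) ∎

*-cancelˡ-2^ : ∀ m {a b : ℤ} → (+ 2) ^ m * a ≡ (+ 2) ^ m * b → a ≡ b
*-cancelˡ-2^ zero    eq = trans (sym (ℤP.*-identityˡ _)) (trans eq (ℤP.*-identityˡ _))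
*-cancelˡ-2^ (suc m) {a} {b} eq = *-cancelˡ-2^ m (ℤP.*-cancelˡ-≡ (+ 2) ((+ 2) ^ m * a) ((+ 2) ^ m * b)
  (trans (sym (ℤP.*-assoc (+ 2) ((+ 2) ^ m) a)) (trans eq (ℤP.*-assoc (+ 2) ((+ 2) ^ m) b))))

∑-signVectors-arrangements : ∀ n (G : List ℤ → ℤ) →
  ∑[ S ∈ signVectors n ] arrangementSum n S [] n G ≡ ∑[ w ∈ words n n ] (if distinctAbs w then G w else + 0)
∑-signVectors-arrangements n G = trans (*-cancelˡ-2^ n (∑-signVectors-arrangementSum n [] n G))
  (∑-cong (words n n) (λ w → cong (λ b → if b then G w else + 0)
    (trans (cong (distinctAbs w ∧_) (avoids-[] w)) (BP.∧-identityʳ (distinctAbs w)))))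

-- Ranks

gt-true : ∀ {a b} → b ℤ.< a → gt a b ≡ true
gt-true {a} {b} b<a with a ≤ᵇ b in a≤ᵇb
... | true  = ⊥-elim (ℤP.<⇒≱ b<a (ℤP.≤ᵇ⇒≤ (subst T (sym a≤ᵇb) tt)))
... | false = refl

gt-false : ∀ {a b} → a ℤ.≤ b → gt a b ≡ false
gt-false {a} {b} a≤b with a ≤ᵇ b in a≤ᵇb
... | true  = refl
... | false = ⊥-elim (subst T a≤ᵇb (ℤP.≤⇒≤ᵇ a≤b))

true≢false : true ≢ false
true≢false ()

gt-true⁻ : ∀ {a b} → gt a b ≡ true → b ℤ.< a
gt-true⁻ a>b = ℤP.≰⇒> (λ a≤b → true≢false (trans (sym a>b) (gt-false a≤b)))

gt-false⁻ : ∀ {a b} → gt a b ≡ false → a ℤ.≤ b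
gt-false⁻ a≯b = ℤP.≮⇒≥ (λ b<a → true≢false (trans (sym (gt-true b<a)) a≯b))

gt-irrefl : ∀ a → gt a a ≡ false
gt-irrefl a = gt-false {a} {a} ℤP.≤-refl

gt-trans : ∀ {a b c} → gt a b ≡ true → gt b c ≡ true → gt a c ≡ true
gt-trans {a} {b} {c} a>b b>c = gt-true {a} {c} (ℤP.<-trans (gt-true⁻ {b} {c} b>c) (gt-true⁻ {a} {b} a>b))

gt-flip : ∀ {a b} → gt a b ≡ false → a ≢ b → gt b a ≡ true
gt-flip {a} {b} a≯b a≢b = gt-true {b} {a} (ℤP.≤∧≢⇒< (gt-false⁻ {a} {b} a≯b) a≢b)

count-mono : ∀ (p q : ℤ → Bool) xs → (∀ {y} → p y ≡ true → q y ≡ true) → count p xs ℕ.≤ count q xs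
count-mono p q []       p⇒q = z≤n
count-mono p q (x ∷ xs) p⇒q with p x in px | q x in qx
... | true  | true  = s≤s (count-mono p q xs p⇒q)
... | true  | false = ⊥-elim (true≢false (trans (sym (p⇒q px)) qx))
... | false | true  = ℕP.m≤n⇒m≤1+n (count-mono p q xs p⇒q)
... | false | false = count-mono p q xs p⇒q

count-strict : ∀ (p q : ℤ → Bool) xs {u} → (∀ {y} → p y ≡ true → q y ≡ true) →
               u ∈ xs → p u ≡ false → q u ≡ true → count p xs ℕ.< count q xs
count-strict p q (x ∷ xs) p⇒q (here refl) pu qu rewrite pu | qu = s≤s (count-mono p q xs p⇒q)
count-strict p q (x ∷ xs) p⇒q (there u∈xs) pu qu with p x in px | q x in qx
... | true  | true  = s≤s (count-strict p q xs p⇒q u∈xs pu qu)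
... | true  | false = ⊥-elim (true≢false (trans (sym (p⇒q px)) qx))
... | false | true  = ℕP.m<n⇒m<1+n (count-strict p q xs p⇒q u∈xs pu qu)
... | false | false = count-strict p q xs p⇒q u∈xs pu qu

count-≤-length : ∀ (p : ℤ → Bool) xs → count p xs ℕ.≤ length xs
count-≤-length p []       = z≤n
count-≤-length p (x ∷ xs) with p x
... | true  = s≤s (count-≤-length p xs)
... | false = ℕP.m≤n⇒m≤1+n (count-≤-length p xs)

rank : List ℤ → ℤ → ℕ
rank V v = count (λ y → gt y v) V

rank-antitone : ∀ V {v w} → gt v w ≡ true → rank V v ℕ.≤ rank V w
rank-antitone V {v} {w} v>w = count-mono _ _ V (λ {y} y>v → gt-trans {y} {v} {w} y>v v>w)

rank-strict : ∀ V {v w} → w ∈ V → gt w v ≡ true → rank V w ℕ.< rank V v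
rank-strict V {v} {w} w∈V w>v = count-strict _ _ V (λ {y} y>w → gt-trans {y} {w} {v} y>w w>v) w∈V (gt-irrefl w) w>v

rank-≤-length : ∀ V v → rank V v ℕ.≤ length V
rank-≤-length V v = count-≤-length _ V

gt≡<ᵇ-rank : ∀ V {a v} → v ∈ V → v ≢ a → gt v a ≡ (rank V v ℕ.<ᵇ rank V a)
gt≡<ᵇ-rank V {a} {v} v∈V v≢a with gt v a in v>a
... | true  = sym (dec-true (rank V v ℕP.<? rank V a) (rank-strict V v∈V v>a))
... | false = sym (dec-false (rank V v ℕP.<? rank V a)
                             (ℕP.≤⇒≯ (rank-antitone V (gt-flip v>a v≢a))))

punchIn : ℕ → ℕ → ℕ
punchIn j c = if j ℕ.≤ᵇ c then suc c else c

∑<-punchIn : ∀ m {j} → j ℕ.≤ m → (F : ℕ → ℤ) → F j + ∑[ c < m ] F (punchIn j c) ≡ ∑< (suc m) F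
∑<-punchIn zero    z≤n F = refl
∑<-punchIn (suc m) {j} j≤1+m F with ℕP.m≤n⇒m<n∨m≡n j≤1+m
... | inj₁ j<1+m = begin
  F j + ∑< (suc m) F′             ≡⟨ cong (_+_ (F j)) (∑<-suc m F′) ⟩
  F j + (∑< m F′ + F′ m)          ≡⟨ sym (ℤP.+-assoc (F j) _ _) ⟩
  (F j + ∑< m F′) + F′ m          ≡⟨ cong₂ _+_ (∑<-punchIn m (s≤s⁻¹ j<1+m) F)
                                               (cong (λ b → F (if b then suc m else m)) (dec-true (j ℕP.≤? m) (s≤s⁻¹ j<1+m))) ⟩
  ∑< (suc m) F + F (suc m)        ≡⟨ sym (∑<-suc (suc m) F) ⟩
  ∑< (suc (suc m)) F              ∎
  where
  open ≡-Reasoning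
  F′ = λ c → F (punchIn j c)
... | inj₂ refl = begin
  F (suc m) + ∑< (suc m) F′       ≡⟨ cong (_+_ (F (suc m))) (∑<-cong (suc m) (λ {c} c<1+m →
                                       cong (λ b → F (if b then suc c else c)) (dec-false (suc m ℕP.≤? c) (ℕP.<⇒≱ c<1+m)))) ⟩
  F (suc m) + ∑< (suc m) F        ≡⟨ ℤP.+-comm (F (suc m)) _ ⟩
  ∑< (suc m) F + F (suc m)        ≡⟨ sym (∑<-suc (suc m) F) ⟩
  ∑< (suc (suc m)) F              ∎
  where
  open ≡-Reasoning
  F′ = λ c → F (punchIn (suc m) c)

rank-∷ : ∀ V {v w} → w ∈ V → v ≢ w → rank (v ∷ V) w ≡ punchIn (rank V v) (rank V w)
rank-∷ V {v} {w} w∈V v≢w with gt v w in v>w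
... | true  = cong (λ b → if b then suc (rank V w) else rank V w)
                   (sym (dec-true (rank V v ℕP.≤? rank V w) (rank-antitone V v>w)))
... | false = cong (λ b → if b then suc (rank V w) else rank V w)
                   (sym (dec-false (rank V v ℕP.≤? rank V w) (ℕP.<⇒≱ (rank-strict V w∈V (gt-flip v>w v≢w)))))

∑-by-rank : ∀ V → Unique V → (F : ℕ → ℤ) → ∑[ v ∈ V ] F (rank V v) ≡ ∑< (length V) F
∑-by-rank []      _            F = refl
∑-by-rank (v ∷ V) (v∉V ∷ uniq) F = begin
  F (rank (v ∷ V) v) + ∑[ w ∈ V ] F (rank (v ∷ V) w)
    ≡⟨ cong₂ _+_ (cong (λ b → F ((if b then 1 else 0) ℕ.+ rank V v)) (gt-irrefl v))
                 (∑-cong-∈ V (λ w∈V → cong F (rank-∷ V w∈V (All.lookup v∉V w∈V)))) ⟩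
  F (rank V v) + ∑[ w ∈ V ] F (punchIn (rank V v) (rank V w))
    ≡⟨ cong (_+_ (F (rank V v))) (∑-by-rank V uniq (F ∘ punchIn (rank V v))) ⟩
  F (rank V v) + ∑[ c < length V ] F (punchIn (rank V v) c)
    ≡⟨ ∑<-punchIn (length V) (rank-≤-length V v) F ⟩
  ∑< (suc (length V)) F ∎
  where open ≡-Reasoning

-- Geometric sums

qint-+ : ∀ y a b → qint (a ℕ.+ b) y ≡ qint a y + y ^ a * qint b y
qint-+ y a zero    = begin
  qint (a ℕ.+ 0) y          ≡⟨ cong (λ m → qint m y) (ℕP.+-identityʳ a) ⟩
  qint a y                  ≡⟨ sym (ℤP.+-identityʳ _) ⟩
  qint a y + + 0            ≡⟨ cong (_+_ (qint a y)) (sym (ℤP.*-zeroʳ (y ^ a))) ⟩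
  qint a y + y ^ a * + 0    ∎
  where open ≡-Reasoning
qint-+ y a (suc b) = begin
  qint (a ℕ.+ suc b) y                              ≡⟨ cong (λ m → qint m y) (ℕP.+-suc a b) ⟩
  qint (suc (a ℕ.+ b)) y                            ≡⟨ ∑<-suc (a ℕ.+ b) (y ^_) ⟩
  qint (a ℕ.+ b) y + y ^ (a ℕ.+ b)                  ≡⟨ cong₂ _+_ (qint-+ y a b) (ℤP.^-distribˡ-+-* y a b) ⟩
  (qint a y + y ^ a * qint b y) + y ^ a * y ^ b     ≡⟨ factor (qint a y) (y ^ a) (qint b y) (y ^ b) ⟩
  qint a y + y ^ a * (qint b y + y ^ b)             ≡⟨ cong (λ t → qint a y + y ^ a * t) (sym (∑<-suc b (y ^_))) ⟩
  qint a y + y ^ a * qint (suc b) y                 ∎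
  where
  open ≡-Reasoning
  factor : ∀ s p t u → (s + p * t) + p * u ≡ s + p * (t + u)
  factor = solve-∀

∑<-geometric-split : ∀ y X m {g} → g ℕ.≤ m →
  ∑[ c < m ] (y ^ c * (if c ℕ.<ᵇ g then X else + 1)) ≡ X * qint g y + (qint m y - qint g y)
∑<-geometric-split y X zero    z≤n = sym (cong (_+ + 0) (ℤP.*-zeroʳ X))
∑<-geometric-split y X (suc m) {g} g≤1+m with ℕP.m≤n⇒m<n∨m≡n g≤1+m
... | inj₁ g<1+m = begin
  ∑< (suc m) f                                  ≡⟨ ∑<-suc m f ⟩
  ∑< m f + f m                                  ≡⟨ cong₂ _+_ (∑<-geometric-split y X m (s≤s⁻¹ g<1+m))
                                                     (cong (λ b → y ^ m * (if b then X else + 1))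
                                                           (dec-false (m ℕP.<? g) (ℕP.≤⇒≯ (s≤s⁻¹ g<1+m)))) ⟩
  (X * qint g y + (qint m y - qint g y)) + y ^ m * + 1
                                                ≡⟨ regroup X (qint g y) (qint m y) (y ^ m) ⟩
  X * qint g y + ((qint m y + y ^ m) - qint g y) ≡⟨ cong (λ t → X * qint g y + (t - qint g y)) (sym (∑<-suc m (y ^_))) ⟩
  X * qint g y + (qint (suc m) y - qint g y)    ∎
  where
  open ≡-Reasoning
  f = λ c → y ^ c * (if c ℕ.<ᵇ g then X else + 1)
  regroup : ∀ X s t p → (X * s + (t - s)) + p * + 1 ≡ X * s + ((t + p) - s)
  regroup = solve-∀
... | inj₂ refl = begin
  ∑< (suc m) f                                  ≡⟨ ∑<-cong (suc m) (λ {c} c<1+m →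
                                                     cong (λ b → y ^ c * (if b then X else + 1)) (dec-true (c ℕP.<? suc m) c<1+m)) ⟩
  ∑[ c < suc m ] (y ^ c * X)                    ≡⟨ ∑-cong (upTo (suc m)) (λ c → ℤP.*-comm (y ^ c) X) ⟩
  ∑[ c < suc m ] (X * y ^ c)                    ≡⟨ ∑-*ˡ (upTo (suc m)) X (y ^_) ⟩
  X * qint (suc m) y                            ≡⟨ pad X (qint (suc m) y) ⟩
  X * qint (suc m) y + (qint (suc m) y - qint (suc m) y) ∎
  where
  open ≡-Reasoning
  f = λ c → y ^ c * (if c ℕ.<ᵇ suc m then X else + 1)
  pad : ∀ X s → X * s ≡ X * s + (s - s)
  pad = solve-∀

-- Rotating the first g exponents of 1 + y + ⋯ + y^(m-1) up by m.
geometric-rotate : ∀ y m {g} → g ℕ.≤ m →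
  ∑[ c < m ] (y ^ c * (if c ℕ.<ᵇ g then y ^ m else + 1)) ≡ y ^ g * qint m y
geometric-rotate y m {g} g≤m = begin
  ∑[ c < m ] (y ^ c * (if c ℕ.<ᵇ g then y ^ m else + 1))
                                      ≡⟨ ∑<-geometric-split y (y ^ m) m g≤m ⟩
  y ^ m * qint g y + (qint m y - qint g y)
                                      ≡⟨ regroup (y ^ m * qint g y) (qint m y) (qint g y) ⟩
  (qint m y + y ^ m * qint g y) - qint g y
                                      ≡⟨ cong (_- qint g y) (sym (qint-+ y m g)) ⟩
  qint (m ℕ.+ g) y - qint g y         ≡⟨ cong (λ t → qint t y - qint g y) (ℕP.+-comm m g) ⟩
  qint (g ℕ.+ m) y - qint g y         ≡⟨ cong (_- qint g y) (qint-+ y g m) ⟩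
  (qint g y + y ^ g * qint m y) - qint g y
                                      ≡⟨ cancel (qint g y) (y ^ g * qint m y) ⟩
  y ^ g * qint m y                    ∎
  where
  open ≡-Reasoning
  regroup : ∀ p t s → p + (t - s) ≡ (t + p) - s
  regroup = solve-∀
  cancel : ∀ s p → (s + p) - s ≡ p
  cancel = solve-∀

-- Arrangements of the available entries

count-as-∑ : ∀ (p : ℤ → Bool) w → count p w ≡ ℕΣ.∑ w (λ y → if p y then 1 else 0)
count-as-∑ p []      = refl
count-as-∑ p (y ∷ w) = cong ((if p y then 1 else 0) ℕ.+_) (count-as-∑ p w)

negSum-as-∑ : ∀ w → negSum w ≡ ℕΣ.∑ w (λ y → if isNeg y then ∣ y ∣ else 0)
negSum-as-∑ []      = refl
negSum-as-∑ (y ∷ w) = cong ((if isNeg y then ∣ y ∣ else 0) ℕ.+_) (negSum-as-∑ w)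

length-as-∑ : ∀ {A : Set} (w : List A) → length w ≡ ℕΣ.∑ w (λ _ → 1)
length-as-∑ []      = refl
length-as-∑ (y ∷ w) = cong suc (length-as-∑ w)

∣signed∣ : ∀ b i → ∣ signed b i ∣ ≡ suc i
∣signed∣ true  i = refl
∣signed∣ false i = refl

entry-injective : ∀ S {i j} → entry S i ≡ entry S j → i ≡ j
entry-injective S {i} {j} eq =
  ℕP.suc-injective (trans (sym (∣signed∣ (signAt S i) i)) (trans (cong ∣_∣ eq) (∣signed∣ (signAt S j) j)))

available : ℕ → List Bool → List ℕ → List ℤ
available n S U = map (entry S) (filterᵇ (λ i → suc i ∉ᵇ U) (upTo n))

available-unique : ∀ n S U → Unique (available n S U)
available-unique n S U = UP.map⁺ (entry-injective S) (UP.filter⁺ (T? ∘ (λ i → suc i ∉ᵇ U)) (UP.upTo⁺ n))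

available-∈ : ∀ n S U {v} → v ∈ available n S U → ∃[ i ] i ℕ.< n × (suc i ∉ᵇ U) ≡ true × v ≡ entry S i
available-∈ n S U v∈ with MP.∈-map∘filter⁻ (entry S) (T? ∘ (λ i → suc i ∉ᵇ U)) v∈
... | i , i∈upTo , v≡ , fresh = i , MP.∈-upTo⁻ i∈upTo , Equivalence.to BP.T-≡ fresh , v≡

available-∉ : ∀ n S U {i v} → v ∈ available n S (suc i ∷ U) → v ≢ entry S i
available-∉ n S U {i} v∈ v≡ with available-∈ n S (suc i ∷ U) v∈
... | j , _ , fresh , refl = proj₁ (∉ᵇ-∷⁻ (suc j) (suc i) U fresh) (cong suc (entry-injective S v≡))

∑-available-remove : ∀ n S U {i} → i ℕ.< n → (suc i ∉ᵇ U) ≡ true → (h : ℤ → ℕ) →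
  ℕΣ.∑ (available n S U) h ≡ h (entry S i) ℕ.+ ℕΣ.∑ (available n S (suc i ∷ U)) h
∑-available-remove n S U {i} i<n fresh h = begin
  ℕΣ.∑ (available n S U) h
    ≡⟨ ℕΣ.∑-map-filterᵇ (entry S) _ (upTo n) h ⟩
  ℕΣ.∑< n g
    ≡⟨ ℕΣ.∑<-pick n i<n g ⟩
  g i ℕ.+ ℕΣ.∑< n (λ j → if j ℕ.≡ᵇ i then 0 else g j)
    ≡⟨ cong₂ ℕ._+_ (cong (λ b → if b then h (entry S i) else 0) fresh) (ℕΣ.∑<-cong n (λ {j} _ → drop-i j)) ⟩
  h (entry S i) ℕ.+ ℕΣ.∑< n g′
    ≡⟨ cong (h (entry S i) ℕ.+_) (sym (ℕΣ.∑-map-filterᵇ (entry S) _ (upTo n) h)) ⟩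
  h (entry S i) ℕ.+ ℕΣ.∑ (available n S (suc i ∷ U)) h ∎
  where
  open ≡-Reasoning
  g g′ : ℕ → ℕ
  g  j = if suc j ∉ᵇ U then h (entry S j) else 0
  g′ j = if suc j ∉ᵇ (suc i ∷ U) then h (entry S j) else 0
  drop-i : ∀ j → (if j ℕ.≡ᵇ i then 0 else g j) ≡ g′ j
  drop-i j with j ℕ.≡ᵇ i
  ... | true  = refl
  ... | false = refl

length-available-remove : ∀ n S U {i} → i ℕ.< n → (suc i ∉ᵇ U) ≡ true →
  length (available n S U) ≡ suc (length (available n S (suc i ∷ U)))
length-available-remove n S U i<n fresh = trans (length-as-∑ (available n S U))
  (trans (∑-available-remove n S U i<n fresh (λ _ → 1)) (cong suc (sym (length-as-∑ (available n S (suc _ ∷ U))))))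

rank-available-remove : ∀ n S U {i} → i ℕ.< n → (suc i ∉ᵇ U) ≡ true →
  rank (available n S (suc i ∷ U)) (entry S i) ≡ rank (available n S U) (entry S i)
rank-available-remove n S U {i} i<n fresh = begin
  rank (available n S (suc i ∷ U)) (entry S i)
    ≡⟨ count-as-∑ _ (available n S (suc i ∷ U)) ⟩
  ℕΣ.∑ (available n S (suc i ∷ U)) [>b]
    ≡⟨ cong (λ t → (if t then 1 else 0) ℕ.+ ℕΣ.∑ (available n S (suc i ∷ U)) [>b]) (sym (gt-irrefl (entry S i))) ⟩
  [>b] (entry S i) ℕ.+ ℕΣ.∑ (available n S (suc i ∷ U)) [>b]
    ≡⟨ sym (∑-available-remove n S U i<n fresh [>b]) ⟩
  ℕΣ.∑ (available n S U) [>b]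
    ≡⟨ sym (count-as-∑ _ (available n S U)) ⟩
  rank (available n S U) (entry S i) ∎
  where
  open ≡-Reasoning
  [>b] = λ y → if gt y (entry S i) then 1 else 0

data Arrangement (n : ℕ) (S : List Bool) : List ℕ → ℕ → List ℤ → Set where
  []   : ∀ {U} → Arrangement n S U zero []
  cons : ∀ {U k w} i → i ℕ.< n → (suc i ∉ᵇ U) ≡ true →
         Arrangement n S (suc i ∷ U) k w → Arrangement n S U (suc k) (entry S i ∷ w)

arrangementSum-cong : ∀ n S U k {G G′ : List ℤ → ℤ} → (∀ {w} → Arrangement n S U k w → G w ≡ G′ w) →
                      arrangementSum n S U k G ≡ arrangementSum n S U k G′
arrangementSum-cong n S U zero    G≡G′ = G≡G′ []
arrangementSum-cong n S U (suc k) {G} {G′} G≡G′ = ∑<-cong n (λ {i} i<n → step i i<n)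
  where
  step : ∀ i → i ℕ.< n → (if suc i ∉ᵇ U then arrangementSum n S (suc i ∷ U) k (G ∘ (entry S i ∷_)) else + 0)
                        ≡ (if suc i ∉ᵇ U then arrangementSum n S (suc i ∷ U) k (G′ ∘ (entry S i ∷_)) else + 0)
  step i i<n with suc i ∉ᵇ U in fresh
  ... | false = refl
  ... | true  = arrangementSum-cong n S (suc i ∷ U) k (λ arr → G≡G′ (cons i i<n fresh arr))

arrangementSum-*ˡ : ∀ n S U k (c : ℤ) (G : List ℤ → ℤ) →
                    arrangementSum n S U k (λ w → c * G w) ≡ c * arrangementSum n S U k G
arrangementSum-*ˡ n S U zero    c G = refl
arrangementSum-*ˡ n S U (suc k) c G = trans (∑<-cong n (λ {i} _ → step i)) (∑-*ˡ (upTo n) c _)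
  where
  step : ∀ i → (if suc i ∉ᵇ U then arrangementSum n S (suc i ∷ U) k (λ w → c * G (entry S i ∷ w)) else + 0)
             ≡ c * (if suc i ∉ᵇ U then arrangementSum n S (suc i ∷ U) k (G ∘ (entry S i ∷_)) else + 0)
  step i with suc i ∉ᵇ U
  ... | false = sym (ℤP.*-zeroʳ c)
  ... | true  = arrangementSum-*ˡ n S (suc i ∷ U) k c _

Arrangement-∑ : ∀ {n S U k w} → Arrangement n S U k w → length (available n S U) ≡ k → (h : ℤ → ℕ) →
                ℕΣ.∑ w h ≡ ℕΣ.∑ (available n S U) h
Arrangement-∑ {n} {S} {U} [] len h with available n S U | len
... | [] | refl = refl
Arrangement-∑ {n} {S} {U} (cons {w = w} i i<n fresh arr) len h = begin
  h (entry S i) ℕ.+ ℕΣ.∑ w h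
    ≡⟨ cong (h (entry S i) ℕ.+_) (Arrangement-∑ arr len′ h) ⟩
  h (entry S i) ℕ.+ ℕΣ.∑ (available n S (suc i ∷ U)) h
    ≡⟨ sym (∑-available-remove n S U i<n fresh h) ⟩
  ℕΣ.∑ (available n S U) h ∎
  where
  open ≡-Reasoning
  len′ = ℕP.suc-injective (trans (sym (length-available-remove n S U i<n fresh)) len)

Arrangement-count : ∀ {n S U k w} → Arrangement n S U k w → length (available n S U) ≡ k → (p : ℤ → Bool) →
                    count p w ≡ count p (available n S U)
Arrangement-count {n} {S} {U} {w = w} arr len p =
  trans (count-as-∑ p w) (trans (Arrangement-∑ arr len (λ y → if p y then 1 else 0)) (sym (count-as-∑ p (available n S U))))

Arrangement-length : ∀ {n S U k w} → Arrangement n S U k w → length (available n S U) ≡ k → length w ≡ k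
Arrangement-length {n} {S} {U} {w = w} arr len =
  trans (length-as-∑ w) (trans (Arrangement-∑ arr len (λ _ → 1)) (trans (sym (length-as-∑ (available n S U))) len))

-- The signed Mahonian distribution

invRev : List ℤ → ℕ
invRev []      = 0
invRev (b ∷ w) = rank w b ℕ.+ invRev w

majRev : ℤ → List ℤ → ℕ
majRev a []      = 0
majRev a (b ∷ w) = (if gt b a then suc (length w) else 0) ℕ.+ majRev b w

count-∷ʳ : ∀ (p : ℤ → Bool) xs a → count p (xs ∷ʳ a) ≡ count p xs ℕ.+ (if p a then 1 else 0)
count-∷ʳ p []       a = ℕP.+-identityʳ _
count-∷ʳ p (x ∷ xs) a = trans (cong ((if p x then 1 else 0) ℕ.+_) (count-∷ʳ p xs a))
                              (sym (ℕP.+-assoc (if p x then 1 else 0) _ _))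

count-reverse : ∀ (p : ℤ → Bool) xs → count p (reverse xs) ≡ count p xs
count-reverse p xs = trans (count-as-∑ p (reverse xs)) (trans (ℕΣ.∑-reverse xs _) (sym (count-as-∑ p xs)))

inv-∷ʳ : ∀ xs a → inv (xs ∷ʳ a) ≡ inv xs ℕ.+ rank xs a
inv-∷ʳ []       a = refl
inv-∷ʳ (x ∷ xs) a = trans (cong₂ ℕ._+_ (count-∷ʳ (gt x) xs a) (inv-∷ʳ xs a))
                          (interchange (count (gt x) xs) (if gt x a then 1 else 0) (inv xs) (rank xs a))
  where
  interchange : ∀ p q r s → (p ℕ.+ q) ℕ.+ (r ℕ.+ s) ≡ (p ℕ.+ r) ℕ.+ (q ℕ.+ s)
  interchange = solveℕ

inv-reverse : ∀ w → inv (reverse w) ≡ invRev w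
inv-reverse []      = refl
inv-reverse (b ∷ w) = begin
  inv (reverse (b ∷ w))                 ≡⟨ cong inv (LP.unfold-reverse b w) ⟩
  inv (reverse w ∷ʳ b)                  ≡⟨ inv-∷ʳ (reverse w) b ⟩
  inv (reverse w) ℕ.+ rank (reverse w) b ≡⟨ cong₂ ℕ._+_ (inv-reverse w) (count-reverse (λ y → gt y b) w) ⟩
  invRev w ℕ.+ rank w b                 ≡⟨ ℕP.+-comm (invRev w) _ ⟩
  invRev (b ∷ w)                        ∎
  where open ≡-Reasoning

majFrom-∷ʳ-∷ʳ : ∀ i xs b a →
  majFrom i (xs ++ b ∷ a ∷ []) ≡ majFrom i (xs ∷ʳ b) ℕ.+ (if gt b a then i ℕ.+ length xs else 0)
majFrom-∷ʳ-∷ʳ i []           b a with gt b a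
... | true  = refl
... | false = refl
majFrom-∷ʳ-∷ʳ i (y ∷ [])     b a = trans (cong ((if gt y b then i else 0) ℕ.+_) (majFrom-∷ʳ-∷ʳ (suc i) [] b a))
  (trans (sym (ℕP.+-assoc (if gt y b then i else 0) _ _))
         (cong (λ t → majFrom i (y ∷ b ∷ []) ℕ.+ (if gt b a then t else 0)) (sym (ℕP.+-suc i 0))))
majFrom-∷ʳ-∷ʳ i (y ∷ z ∷ zs) b a = trans (cong ((if gt y z then i else 0) ℕ.+_) (majFrom-∷ʳ-∷ʳ (suc i) (z ∷ zs) b a))
  (trans (sym (ℕP.+-assoc (if gt y z then i else 0) _ _))
         (cong (λ t → majFrom i (y ∷ z ∷ zs ∷ʳ b) ℕ.+ (if gt b a then t else 0)) (sym (ℕP.+-suc i (length (z ∷ zs))))))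

majN-reverse-∷ : ∀ a w → majN (reverse (a ∷ w)) ≡ majRev a w
majN-reverse-∷ a []      = refl
majN-reverse-∷ a (b ∷ w) = begin
  majN (reverse (a ∷ b ∷ w))
    ≡⟨ cong majN reverse-∷-∷ ⟩
  majFrom 1 (reverse w ++ b ∷ a ∷ [])
    ≡⟨ majFrom-∷ʳ-∷ʳ 1 (reverse w) b a ⟩
  majN (reverse w ∷ʳ b) ℕ.+ (if gt b a then suc (length (reverse w)) else 0)
    ≡⟨ cong₂ ℕ._+_ (trans (cong majN (sym (LP.unfold-reverse b w))) (majN-reverse-∷ b w))
                   (cong (λ t → if gt b a then suc t else 0) (LP.length-reverse w)) ⟩
  majRev b w ℕ.+ (if gt b a then suc (length w) else 0)
    ≡⟨ ℕP.+-comm (majRev b w) _ ⟩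
  majRev a (b ∷ w) ∎
  where
  open ≡-Reasoning
  reverse-∷-∷ : reverse (a ∷ b ∷ w) ≡ reverse w ++ b ∷ a ∷ []
  reverse-∷-∷ = trans (LP.unfold-reverse a (b ∷ w))
    (trans (cong (_∷ʳ a) (LP.unfold-reverse b w)) (LP.++-assoc (reverse w) (b ∷ []) (a ∷ [])))

-- The weight (-1)^inv x^maj of reverse w with a appended: a only contributes a possible final descent.
mahonianWeight : ℤ → ℤ → List ℤ → ℤ
mahonianWeight x a w = -1ℤ ^ invRev w * x ^ majRev a w

mahonianWeight-∷ : ∀ x a b w → mahonianWeight x a (b ∷ w)
  ≡ (-1ℤ ^ rank w b * x ^ (if gt b a then suc (length w) else 0)) * mahonianWeight x b w
mahonianWeight-∷ x a b w = trans
  (cong₂ _*_ (ℤP.^-distribˡ-+-* -1ℤ (rank w b) (invRev w))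
             (ℤP.^-distribˡ-+-* x (if gt b a then suc (length w) else 0) (majRev b w)))
  (interchange (-1ℤ ^ rank w b) (-1ℤ ^ invRev w) (x ^ (if gt b a then suc (length w) else 0)) (x ^ majRev b w))
  where
  interchange : ∀ p q r s → (p * q) * (r * s) ≡ (p * r) * (q * s)
  interchange = solve-∀

^-distribʳ-* : ∀ (a b : ℤ) n → (a * b) ^ n ≡ a ^ n * b ^ n
^-distribʳ-* a b zero    = refl
^-distribʳ-* a b (suc n) = trans (cong ((a * b) *_) (^-distribʳ-* a b n)) (interchange a b (a ^ n) (b ^ n))
  where
  interchange : ∀ p q r s → (p * q) * (r * s) ≡ (p * r) * (q * s)
  interchange = solve-∀

-1^[k*[1+k]] : ∀ k → -1ℤ ^ (k ℕ.* suc k) ≡ + 1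
-1^[k*[1+k]] zero    = refl
-1^[k*[1+k]] (suc k) = begin
  -1ℤ ^ (suc k ℕ.* suc (suc k))                 ≡⟨ cong (-1ℤ ^_) (expand k) ⟩
  -1ℤ ^ (k ℕ.* suc k ℕ.+ 2 ℕ.* suc k)           ≡⟨ ℤP.^-distribˡ-+-* -1ℤ (k ℕ.* suc k) (2 ℕ.* suc k) ⟩
  -1ℤ ^ (k ℕ.* suc k) * -1ℤ ^ (2 ℕ.* suc k)     ≡⟨ cong₂ _*_ (-1^[k*[1+k]] k) (sym (ℤP.^-*-assoc -1ℤ 2 (suc k))) ⟩
  + 1 * (+ 1) ^ suc k                           ≡⟨ cong (+ 1 *_) (ℤP.^-zeroˡ (suc k)) ⟩
  + 1                                           ∎
  where
  open ≡-Reasoning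
  expand : ∀ k → suc k ℕ.* suc (suc k) ≡ k ℕ.* suc k ℕ.+ 2 ℕ.* suc k
  expand = solveℕ

-- altVar x k = (-1)^(k-1) x is the variable of the k-th factor of [n]_{±x}!; the value at 0 is
-- chosen so that altVar x (suc k) ≡ -1ℤ * altVar x k for every k.
altVar : ℤ → ℕ → ℤ
altVar x zero    = - x
altVar x (suc k) = -1ℤ ^ k * x

altVar-suc : ∀ x k → altVar x (suc k) ≡ -1ℤ * altVar x k
altVar-suc x zero    = neg-neg x
  where
  neg-neg : ∀ x → + 1 * x ≡ -1ℤ * (- x)
  neg-neg = solve-∀
altVar-suc x (suc k) = ℤP.*-assoc -1ℤ (-1ℤ ^ k) x

altVar-^-suc : ∀ x k → altVar x (suc k) ^ suc k ≡ x ^ suc k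
altVar-^-suc x k = begin
  (-1ℤ ^ k * x) ^ suc k            ≡⟨ ^-distribʳ-* (-1ℤ ^ k) x (suc k) ⟩
  (-1ℤ ^ k) ^ suc k * x ^ suc k    ≡⟨ cong (_* x ^ suc k) (trans (ℤP.^-*-assoc -1ℤ k (suc k)) (-1^[k*[1+k]] k)) ⟩
  + 1 * x ^ suc k                  ≡⟨ ℤP.*-identityˡ _ ⟩
  x ^ suc k                        ∎
  where open ≡-Reasoning

-- The weight of the arrangements whose last letter is exceeded by c of the other k letters and
-- ends a descent iff b.
lastLetterTerm : ℤ → ℕ → Bool → ℕ → ℤ
lastLetterTerm x k b c = (-1ℤ ^ c * x ^ (if b then suc k else 0)) * (altVar x k ^ c * qfactPM k x)

lastLetterTerm-altVar : ∀ x k b c →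
  lastLetterTerm x k b c ≡ qfactPM k x * (altVar x (suc k) ^ c * (if b then altVar x (suc k) ^ suc k else + 1))
lastLetterTerm-altVar x k b c = begin
  (-1ℤ ^ c * x ^ (if b then suc k else 0)) * (altVar x k ^ c * M)
    ≡⟨ regroup (-1ℤ ^ c) (x ^ (if b then suc k else 0)) (altVar x k ^ c) M ⟩
  M * ((-1ℤ ^ c * altVar x k ^ c) * x ^ (if b then suc k else 0))
    ≡⟨ cong₂ (λ s t → M * (s * t)) (sym Y^c) (descent b) ⟩
  M * (altVar x (suc k) ^ c * (if b then altVar x (suc k) ^ suc k else + 1)) ∎
  where
  open ≡-Reasoning
  M = qfactPM k x
  regroup : ∀ p q r s → (p * q) * (r * s) ≡ s * ((p * r) * q)
  regroup = solve-∀
  Y^c : altVar x (suc k) ^ c ≡ -1ℤ ^ c * altVar x k ^ c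
  Y^c = trans (cong (_^ c) (altVar-suc x k)) (^-distribʳ-* -1ℤ (altVar x k) c)
  descent : ∀ b → x ^ (if b then suc k else 0) ≡ (if b then altVar x (suc k) ^ suc k else + 1)
  descent true  = sym (altVar-^-suc x k)
  descent false = refl

∑-lastLetterTerm : ∀ x k {g} → g ℕ.≤ suc k →
  ∑[ c < suc k ] lastLetterTerm x k (c ℕ.<ᵇ g) c ≡ altVar x (suc k) ^ g * qfactPM (suc k) x
∑-lastLetterTerm x k {g} g≤1+k = begin
  ∑[ c < suc k ] lastLetterTerm x k (c ℕ.<ᵇ g) c
    ≡⟨ ∑-cong (upTo (suc k)) (λ c → lastLetterTerm-altVar x k (c ℕ.<ᵇ g) c) ⟩
  ∑[ c < suc k ] (M * (Y ^ c * (if c ℕ.<ᵇ g then Y ^ suc k else + 1)))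
    ≡⟨ ∑-*ˡ (upTo (suc k)) M _ ⟩
  M * ∑[ c < suc k ] (Y ^ c * (if c ℕ.<ᵇ g then Y ^ suc k else + 1))
    ≡⟨ cong (M *_) (geometric-rotate Y (suc k) g≤1+k) ⟩
  M * (Y ^ g * qint (suc k) Y)
    ≡⟨ x∙yz≈y∙xz M (Y ^ g) (qint (suc k) Y) ⟩
  Y ^ g * qfactPM (suc k) x ∎
  where
  open ≡-Reasoning
  M = qfactPM k x
  Y = altVar x (suc k)
  x∙yz≈y∙xz : ∀ p q r → p * (q * r) ≡ q * (p * r)
  x∙yz≈y∙xz = solve-∀

arrangementSum-peel : ∀ n S U k x a {i} → i ℕ.< n → (suc i ∉ᵇ U) ≡ true → length (available n S (suc i ∷ U)) ≡ k →
  arrangementSum n S (suc i ∷ U) k (mahonianWeight x a ∘ (entry S i ∷_))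
  ≡ (-1ℤ ^ rank (available n S U) (entry S i) * x ^ (if gt (entry S i) a then suc k else 0))
    * arrangementSum n S (suc i ∷ U) k (mahonianWeight x (entry S i))
arrangementSum-peel n S U k x a {i} i<n fresh len = trans
  (arrangementSum-cong n S (suc i ∷ U) k (λ {w} arr → trans (mahonianWeight-∷ x a b w)
    (cong₂ (λ r l → (-1ℤ ^ r * x ^ (if gt b a then suc l else 0)) * mahonianWeight x b w)
           (trans (Arrangement-count arr len (λ y → gt y b)) (rank-available-remove n S U i<n fresh))
           (Arrangement-length arr len))))
  (arrangementSum-*ˡ n S (suc i ∷ U) k coefficient (mahonianWeight x b))
  where
  b = entry S i
  coefficient = -1ℤ ^ rank (available n S U) b * x ^ (if gt b a then suc k else 0)

-- The signed Mahonian identity of Gessel and Simion, for arrangements followed by a fixed letter a.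
arrangementSum-mahonianWeight : ∀ n S x k U a → length (available n S U) ≡ k →
  (∀ {v} → v ∈ available n S U → v ≢ a) →
  arrangementSum n S U k (mahonianWeight x a) ≡ altVar x k ^ rank (available n S U) a * qfactPM k x
arrangementSum-mahonianWeight n S x zero U a len _ with available n S U | len
... | [] | refl = refl
arrangementSum-mahonianWeight n S x (suc k) U a len a∉V = begin
  arrangementSum n S U (suc k) (mahonianWeight x a)
    ≡⟨ ∑<-cong n (λ {i} i<n → peel i i<n) ⟩
  ∑[ i < n ] (if suc i ∉ᵇ U then lastLetterTerm x k (gt (entry S i) a) (rank V (entry S i)) else + 0)
    ≡⟨ ∑-map-filterᵇ (entry S) _ (upTo n) (λ v → lastLetterTerm x k (gt v a) (rank V v)) ⟨
  ∑[ v ∈ V ] lastLetterTerm x k (gt v a) (rank V v)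
    ≡⟨ ∑-cong-∈ V (λ {v} v∈V → cong (λ b → lastLetterTerm x k b (rank V v)) (gt≡<ᵇ-rank V v∈V (a∉V v∈V))) ⟩
  ∑[ v ∈ V ] lastLetterTerm x k (rank V v ℕ.<ᵇ g) (rank V v)
    ≡⟨ ∑-by-rank V (available-unique n S U) (λ c → lastLetterTerm x k (c ℕ.<ᵇ g) c) ⟩
  ∑[ c < length V ] lastLetterTerm x k (c ℕ.<ᵇ g) c
    ≡⟨ cong (λ m → ∑[ c < m ] lastLetterTerm x k (c ℕ.<ᵇ g) c) len ⟩
  ∑[ c < suc k ] lastLetterTerm x k (c ℕ.<ᵇ g) c
    ≡⟨ ∑-lastLetterTerm x k (subst (g ℕ.≤_) len (rank-≤-length V a)) ⟩
  altVar x (suc k) ^ g * qfactPM (suc k) x ∎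
  where
  open ≡-Reasoning
  V = available n S U
  g = rank V a

  peel : ∀ i → i ℕ.< n →
    (if suc i ∉ᵇ U then arrangementSum n S (suc i ∷ U) k (mahonianWeight x a ∘ (entry S i ∷_)) else + 0)
    ≡ (if suc i ∉ᵇ U then lastLetterTerm x k (gt (entry S i) a) (rank V (entry S i)) else + 0)
  peel i i<n with suc i ∉ᵇ U in fresh
  ... | false = refl
  ... | true  = trans (arrangementSum-peel n S U k x a i<n fresh len′)
    (cong (-1ℤ ^ rank V (entry S i) * x ^ (if gt (entry S i) a then suc k else 0) *_)
          (trans (arrangementSum-mahonianWeight n S x k (suc i ∷ U) (entry S i) len′ (available-∉ n S U))
                 (cong (λ r → altVar x k ^ r * qfactPM k x) (rank-available-remove n S U i<n fresh))))
    where
    len′ = ℕP.suc-injective (trans (sym (length-available-remove n S U i<n fresh)) len)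

-- Sums over sign vectors

negCount : List Bool → ℕ → ℕ
negCount S n = ℕΣ.∑< n (λ i → if signAt S i then 1 else 0)

negTotal : List Bool → ℕ → ℕ
negTotal S n = ℕΣ.∑< n (λ i → if signAt S i then suc i else 0)

negCount-∷ : ∀ s S n → negCount (s ∷ S) (suc n) ≡ (if s then 1 else 0) ℕ.+ negCount S n
negCount-∷ s S n = ℕΣ.∑<-suc-front n _

negTotal-∷ : ∀ s S n → negTotal (s ∷ S) (suc n) ≡ (if s then 1 else 0) ℕ.+ (negTotal S n ℕ.+ negCount S n)
negTotal-∷ s S n = trans (ℕΣ.∑<-suc-front n _) (cong ((if s then 1 else 0) ℕ.+_)
  (trans (ℕΣ.∑-cong (upTo n) (λ i → split (signAt S i) i)) (ℕΣ.∑-∙ (upTo n) _ _)))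
  where
  split : ∀ b i → (if b then suc (suc i) else 0) ≡ (if b then suc i else 0) ℕ.+ (if b then 1 else 0)
  split true  i = sym (ℕP.+-comm (suc i) 1)
  split false i = refl

signGen : ℤ → ℕ → ℤ
signGen t n = ∑[ S ∈ signVectors n ] (-1ℤ ^ negTotal S n * t ^ negCount S n)

-1^[m+n]*t^n : ∀ (t : ℤ) m n → -1ℤ ^ (m ℕ.+ n) * t ^ n ≡ -1ℤ ^ m * (- t) ^ n
-1^[m+n]*t^n t m n = begin
  -1ℤ ^ (m ℕ.+ n) * t ^ n             ≡⟨ cong (_* t ^ n) (ℤP.^-distribˡ-+-* -1ℤ m n) ⟩
  (-1ℤ ^ m * -1ℤ ^ n) * t ^ n         ≡⟨ ℤP.*-assoc (-1ℤ ^ m) (-1ℤ ^ n) (t ^ n) ⟩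
  -1ℤ ^ m * (-1ℤ ^ n * t ^ n)         ≡⟨ cong (-1ℤ ^ m *_) (sym (^-distribʳ-* -1ℤ t n)) ⟩
  -1ℤ ^ m * (-1ℤ * t) ^ n             ≡⟨ cong (λ s → -1ℤ ^ m * s ^ n) (ℤP.-1*i≡-i t) ⟩
  -1ℤ ^ m * (- t) ^ n                 ∎
  where open ≡-Reasoning

-- The sign of the entry 1 shifts the absolute values of all later entries by one, which t ↦ -t absorbs.
signGen-suc : ∀ t n → signGen t (suc n) ≡ (+ 1 - t) * signGen (- t) n
signGen-suc t n = begin
  signGen t (suc n)
    ≡⟨ ∑-signVectors-suc n _ ⟩
  ∑[ S ∈ signVectors n ] term (false ∷ S) + ∑[ S ∈ signVectors n ] term (true ∷ S)
    ≡⟨ cong₂ _+_ (∑-cong (signVectors n) positive) (∑-cong (signVectors n) negative) ⟩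
  signGen (- t) n + ∑[ S ∈ signVectors n ] (- t * f S)
    ≡⟨ cong (_+_ (signGen (- t) n)) (∑-*ˡ (signVectors n) (- t) f) ⟩
  signGen (- t) n + - t * signGen (- t) n
    ≡⟨ factor t (signGen (- t) n) ⟩
  (+ 1 - t) * signGen (- t) n ∎
  where
  open ≡-Reasoning
  term : List Bool → ℤ
  term S = -1ℤ ^ negTotal S (suc n) * t ^ negCount S (suc n)
  f : List Bool → ℤ
  f S = -1ℤ ^ negTotal S n * (- t) ^ negCount S n
  positive : ∀ S → term (false ∷ S) ≡ f S
  positive S = trans (cong₂ (λ a b → -1ℤ ^ a * t ^ b) (negTotal-∷ false S n) (negCount-∷ false S n))
                     (-1^[m+n]*t^n t (negTotal S n) (negCount S n))
  negative : ∀ S → term (true ∷ S) ≡ - t * f S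
  negative S = begin
    term (true ∷ S)
      ≡⟨ cong₂ (λ a b → -1ℤ ^ a * t ^ b) (negTotal-∷ true S n) (negCount-∷ true S n) ⟩
    (-1ℤ * -1ℤ ^ (negTotal S n ℕ.+ negCount S n)) * (t * t ^ negCount S n)
      ≡⟨ regroup t (-1ℤ ^ (negTotal S n ℕ.+ negCount S n)) (t ^ negCount S n) ⟩
    - t * (-1ℤ ^ (negTotal S n ℕ.+ negCount S n) * t ^ negCount S n)
      ≡⟨ cong (- t *_) (-1^[m+n]*t^n t (negTotal S n) (negCount S n)) ⟩
    - t * f S ∎
    where
    regroup : ∀ t a b → (-1ℤ * a) * (t * b) ≡ - t * (a * b)
    regroup = solve-∀
  factor : ∀ t g → g + - t * g ≡ (+ 1 - t) * g
  factor = solve-∀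

signGen-suc-suc : ∀ t n → signGen t (suc (suc n)) ≡ (+ 1 - t * t) * signGen t n
signGen-suc-suc t n = begin
  signGen t (suc (suc n))                 ≡⟨ signGen-suc t (suc n) ⟩
  (+ 1 - t) * signGen (- t) (suc n)       ≡⟨ cong ((+ 1 - t) *_) (signGen-suc (- t) n) ⟩
  (+ 1 - t) * ((+ 1 - - t) * signGen (- - t) n)
                                          ≡⟨ cong (λ s → (+ 1 - t) * ((+ 1 - - t) * signGen s n)) (ℤP.neg-involutive t) ⟩
  (+ 1 - t) * ((+ 1 - - t) * signGen t n) ≡⟨ difference-of-squares t (signGen t n) ⟩
  (+ 1 - t * t) * signGen t n             ∎
  where
  open ≡-Reasoning
  difference-of-squares : ∀ t g → (+ 1 - t) * ((+ 1 - - t) * g) ≡ (+ 1 - t * t) * g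
  difference-of-squares = solve-∀

signGen-+-signGen-neg : ∀ q n → signGen q n + signGen (- q) n ≡ + 2 * (+ 1 - q ^ 2) ^ (n / 2)
signGen-+-signGen-neg q zero          = refl
signGen-+-signGen-neg q (suc zero)    = trans (cong₂ _+_ (signGen-suc q 0) (signGen-suc (- q) 0)) (two q)
  where
  two : ∀ q → (+ 1 - q) * + 1 + (+ 1 - - q) * + 1 ≡ + 2 * + 1
  two = solve-∀
signGen-+-signGen-neg q (suc (suc n)) = begin
  signGen q (suc (suc n)) + signGen (- q) (suc (suc n))
    ≡⟨ cong₂ _+_ (signGen-suc-suc q n) (signGen-suc-suc (- q) n) ⟩
  (+ 1 - q * q) * signGen q n + (+ 1 - - q * - q) * signGen (- q) n
    ≡⟨ factor q (signGen q n) (signGen (- q) n) ⟩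
  (+ 1 - q * q) * (signGen q n + signGen (- q) n)
    ≡⟨ cong (λ s → (+ 1 - q * s) * (signGen q n + signGen (- q) n)) (sym (ℤP.*-identityʳ q)) ⟩
  (+ 1 - q ^ 2) * (signGen q n + signGen (- q) n)
    ≡⟨ cong ((+ 1 - q ^ 2) *_) (signGen-+-signGen-neg q n) ⟩
  (+ 1 - q ^ 2) * (+ 2 * (+ 1 - q ^ 2) ^ (n / 2))
    ≡⟨ ℤP.*-comm (+ 1 - q ^ 2) _ ⟩
  + 2 * (+ 1 - q ^ 2) ^ (n / 2) * (+ 1 - q ^ 2)
    ≡⟨ regroup (+ 2) (+ 1 - q ^ 2) (n / 2) ⟩
  + 2 * (+ 1 - q ^ 2) ^ suc (n / 2)
    ≡⟨ cong (λ e → + 2 * (+ 1 - q ^ 2) ^ e) (sym (ℕDM.m/n≡1+[m∸n]/n {suc (suc n)} {2} (s≤s (s≤s z≤n)))) ⟩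
  + 2 * (+ 1 - q ^ 2) ^ (suc (suc n) / 2) ∎
  where
  open ≡-Reasoning
  factor : ∀ q a b → (+ 1 - q * q) * a + (+ 1 - - q * - q) * b ≡ (+ 1 - q * q) * (a + b)
  factor = solve-∀
  regroup : ∀ c x e → c * x ^ e * x ≡ c * x ^ suc e
  regroup c x e = trans (ℤP.*-assoc c (x ^ e) x) (cong (c *_) (ℤP.*-comm (x ^ e) x))

signWeight : ℤ → List Bool → ℕ → ℤ
signWeight q S n = if isEven (negCount S n) then -1ℤ ^ negTotal S n * q ^ negCount S n else + 0

-1^-isEven : ∀ m → -1ℤ ^ m ≡ (if isEven m then + 1 else -1ℤ)
-1^-isEven zero          = refl
-1^-isEven (suc zero)    = refl
-1^-isEven (suc (suc m)) = trans (square (-1ℤ ^ m)) (-1^-isEven m)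
  where
  square : ∀ a → -1ℤ * (-1ℤ * a) ≡ a
  square = solve-∀

even-part : ∀ m (c q : ℤ) → + 2 * (if isEven m then c * q ^ m else + 0) ≡ c * q ^ m + c * (- q) ^ m
even-part m c q = begin
  + 2 * (if isEven m then c * q ^ m else + 0)
    ≡⟨ by-parity (isEven m) (-1^-isEven m) ⟩
  c * q ^ m + c * (-1ℤ ^ m * q ^ m)
    ≡⟨ cong (λ s → c * q ^ m + c * s) (trans (sym (^-distribʳ-* -1ℤ q m)) (cong (_^ m) (ℤP.-1*i≡-i q))) ⟩
  c * q ^ m + c * (- q) ^ m ∎
  where
  open ≡-Reasoning
  by-parity : ∀ b → -1ℤ ^ m ≡ (if b then + 1 else -1ℤ) →
              + 2 * (if b then c * q ^ m else + 0) ≡ c * q ^ m + c * (-1ℤ ^ m * q ^ m)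
  by-parity true  sgn rewrite sgn = double c (q ^ m)
    where
    double : ∀ c p → + 2 * (c * p) ≡ c * p + c * (+ 1 * p)
    double = solve-∀
  by-parity false sgn rewrite sgn = cancel c (q ^ m)
    where
    cancel : ∀ c p → + 2 * + 0 ≡ c * p + c * (-1ℤ * p)
    cancel = solve-∀

∑-signWeight : ∀ q n → ∑[ S ∈ signVectors n ] signWeight q S n ≡ (+ 1 - q ^ 2) ^ (n / 2)
∑-signWeight q n = ℤP.*-cancelˡ-≡ (+ 2) _ _ (begin
  + 2 * ∑[ S ∈ signVectors n ] signWeight q S n
    ≡⟨ sym (∑-*ˡ (signVectors n) (+ 2) (λ S → signWeight q S n)) ⟩
  ∑[ S ∈ signVectors n ] (+ 2 * signWeight q S n)
    ≡⟨ ∑-cong (signVectors n) (λ S → even-part (negCount S n) (-1ℤ ^ negTotal S n) q) ⟩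
  ∑[ S ∈ signVectors n ] (-1ℤ ^ negTotal S n * q ^ negCount S n + -1ℤ ^ negTotal S n * (- q) ^ negCount S n)
    ≡⟨ ∑-∙ (signVectors n) _ _ ⟩
  signGen q n + signGen (- q) n
    ≡⟨ signGen-+-signGen-neg q n ⟩
  + 2 * (+ 1 - q ^ 2) ^ (n / 2) ∎)
  where open ≡-Reasoning

-- The flag-major generating function of D_n

entry-< : ∀ S {n i} → i ℕ.< n → entry S i ℤ.< + suc n
entry-< S {i = i} i<n with signAt S i
... | true  = ℤ.-<+
... | false = ℤ.+<+ (s≤s i<n)

available-< : ∀ n S U {v} → v ∈ available n S U → v ℤ.< + suc n
available-< n S U v∈ with available-∈ n S U v∈
... | i , i<n , _ , refl = entry-< S i<n

count-none : ∀ (p : ℤ → Bool) xs → (∀ {y} → y ∈ xs → p y ≡ false) → count p xs ≡ 0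
count-none p []       none = refl
count-none p (x ∷ xs) none rewrite none (here refl) = count-none p xs (none ∘ there)

rank-above-available : ∀ n S U → rank (available n S U) (+ suc n) ≡ 0
rank-above-available n S U = count-none _ _ (λ y∈ → gt-false (ℤP.<⇒≤ (available-< n S U y∈)))

majN-reverse-Arrangement : ∀ {n S U k w} → Arrangement n S U k w → majN (reverse w) ≡ majRev (+ suc n) w
majN-reverse-Arrangement []                       = refl
majN-reverse-Arrangement {S = S} (cons {w = w} i i<n _ _) = trans (majN-reverse-∷ (entry S i) w)
  (cong (λ b → (if b then suc (length w) else 0) ℕ.+ majRev (entry S i) w) (sym (gt-false (ℤP.<⇒≤ (entry-< S i<n)))))

∑-available-[] : ∀ n S (h : ℤ → ℕ) → ℕΣ.∑ (available n S []) h ≡ ℕΣ.∑< n (h ∘ entry S)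
∑-available-[] n S h = ℕΣ.∑-map-filterᵇ (entry S) _ (upTo n) h

length-available-[] : ∀ n S → length (available n S []) ≡ n
length-available-[] n S = trans (length-as-∑ (available n S []))
  (trans (∑-available-[] n S (λ _ → 1)) (trans (sym (length-as-∑ (upTo n))) (LP.length-upTo n)))

neg-reverse-Arrangement : ∀ {n S w} → Arrangement n S [] n w → neg (reverse w) ≡ negCount S n
neg-reverse-Arrangement {n} {S} {w} arr = begin
  neg (reverse w)                     ≡⟨ count-reverse isNeg w ⟩
  count isNeg w                       ≡⟨ Arrangement-count arr (length-available-[] n S) isNeg ⟩
  count isNeg (available n S [])      ≡⟨ count-as-∑ isNeg (available n S []) ⟩
  ℕΣ.∑ (available n S []) _           ≡⟨ ∑-available-[] n S _ ⟩
  ℕΣ.∑< n _                           ≡⟨ ℕΣ.∑-cong (upTo n) (λ i → isNeg-signed (signAt S i) i) ⟩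
  negCount S n                        ∎
  where
  open ≡-Reasoning
  isNeg-signed : ∀ b i → (if isNeg (signed b i) then 1 else 0) ≡ (if b then 1 else 0)
  isNeg-signed true  i = refl
  isNeg-signed false i = refl

negSum-reverse-Arrangement : ∀ {n S w} → Arrangement n S [] n w → negSum (reverse w) ≡ negTotal S n
negSum-reverse-Arrangement {n} {S} {w} arr = begin
  negSum (reverse w)                  ≡⟨ negSum-as-∑ (reverse w) ⟩
  ℕΣ.∑ (reverse w) h                  ≡⟨ ℕΣ.∑-reverse w h ⟩
  ℕΣ.∑ w h                            ≡⟨ Arrangement-∑ arr (length-available-[] n S) h ⟩
  ℕΣ.∑ (available n S []) h           ≡⟨ ∑-available-[] n S h ⟩
  ℕΣ.∑< n (h ∘ entry S)               ≡⟨ ℕΣ.∑-cong (upTo n) (λ i → negPart-signed (signAt S i) i) ⟩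
  negTotal S n                        ∎
  where
  open ≡-Reasoning
  h = λ y → if isNeg y then ∣ y ∣ else 0
  negPart-signed : ∀ b i → h (signed b i) ≡ (if b then suc i else 0)
  negPart-signed true  i = refl
  negPart-signed false i = refl

lhsTerm-factor : ∀ q σ {A I B M} → neg σ ≡ A → inv σ ≡ I → negSum σ ≡ B → majN σ ≡ M →
  lhsTerm q σ ≡ (if isEven A then -1ℤ ^ B * q ^ A else + 0) * (-1ℤ ^ I * (q ^ 2) ^ M)
lhsTerm-factor q σ refl refl refl refl with isEven (neg σ)
... | false = refl
... | true  = begin
  -1ℤ ^ (I ℕ.+ B) * q ^ (2 ℕ.* M ℕ.+ A)
    ≡⟨ cong₂ _*_ (ℤP.^-distribˡ-+-* -1ℤ I B) (ℤP.^-distribˡ-+-* q (2 ℕ.* M) A) ⟩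
  (-1ℤ ^ I * -1ℤ ^ B) * (q ^ (2 ℕ.* M) * q ^ A)
    ≡⟨ cong (λ t → (-1ℤ ^ I * -1ℤ ^ B) * (t * q ^ A)) (sym (ℤP.^-*-assoc q 2 M)) ⟩
  (-1ℤ ^ I * -1ℤ ^ B) * ((q ^ 2) ^ M * q ^ A)
    ≡⟨ regroup (-1ℤ ^ I) (-1ℤ ^ B) ((q ^ 2) ^ M) (q ^ A) ⟩
  (-1ℤ ^ B * q ^ A) * (-1ℤ ^ I * (q ^ 2) ^ M) ∎
  where
  open ≡-Reasoning
  A = neg σ
  I = inv σ
  B = negSum σ
  M = majN σ
  regroup : ∀ a b c d → (a * b) * (c * d) ≡ (b * d) * (a * c)
  regroup = solve-∀

-- + suc n exceeds every entry, so as a right neighbour it adds no descent.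
lhsTerm-reverse-Arrangement : ∀ {n S w} q → Arrangement n S [] n w →
  lhsTerm q (reverse w) ≡ signWeight q S n * mahonianWeight (q ^ 2) (+ suc n) w
lhsTerm-reverse-Arrangement {w = w} q arr = lhsTerm-factor q (reverse w)
  (neg-reverse-Arrangement arr) (inv-reverse w) (negSum-reverse-Arrangement arr) (majN-reverse-Arrangement arr)

arrangementSum-lhsTerm : ∀ n S q → arrangementSum n S [] n (lhsTerm q ∘ reverse) ≡ signWeight q S n * qfactPM n (q ^ 2)
arrangementSum-lhsTerm n S q = begin
  arrangementSum n S [] n (lhsTerm q ∘ reverse)
    ≡⟨ arrangementSum-cong n S [] n (lhsTerm-reverse-Arrangement q) ⟩
  arrangementSum n S [] n (λ w → signWeight q S n * mahonianWeight (q ^ 2) (+ suc n) w)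
    ≡⟨ arrangementSum-*ˡ n S [] n (signWeight q S n) _ ⟩
  signWeight q S n * arrangementSum n S [] n (mahonianWeight (q ^ 2) (+ suc n))
    ≡⟨ cong (signWeight q S n *_) (arrangementSum-mahonianWeight n S (q ^ 2) n [] (+ suc n)
         (length-available-[] n S) (ℤP.<⇒≢ ∘ available-< n S [])) ⟩
  signWeight q S n * (altVar (q ^ 2) n ^ rank (available n S []) (+ suc n) * qfactPM n (q ^ 2))
    ≡⟨ cong (λ r → signWeight q S n * (altVar (q ^ 2) n ^ r * qfactPM n (q ^ 2))) (rank-above-available n S []) ⟩
  signWeight q S n * (+ 1 * qfactPM n (q ^ 2))
    ≡⟨ cong (signWeight q S n *_) (ℤP.*-identityˡ _) ⟩
  signWeight q S n * qfactPM n (q ^ 2) ∎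
  where open ≡-Reasoning

mainTheorem6 : (n : ℕ) → 1 ≤ n → (q : ℤ) → lhs n q ≡ rhs n q
mainTheorem6 n _ q = begin
  lhs n q
    ≡⟨ lhs-reversed n q ⟩
  ∑[ w ∈ words n n ] (if distinctAbs w then lhsTerm q (reverse w) else + 0)
    ≡⟨ sym (∑-signVectors-arrangements n (lhsTerm q ∘ reverse)) ⟩
  ∑[ S ∈ signVectors n ] arrangementSum n S [] n (lhsTerm q ∘ reverse)
    ≡⟨ ∑-cong (signVectors n) (λ S → arrangementSum-lhsTerm n S q) ⟩
  ∑[ S ∈ signVectors n ] (signWeight q S n * qfactPM n (q ^ 2))
    ≡⟨ ∑-*ʳ (signVectors n) (λ S → signWeight q S n) (qfactPM n (q ^ 2)) ⟩
  (∑[ S ∈ signVectors n ] signWeight q S n) * qfactPM n (q ^ 2)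
    ≡⟨ cong (_* qfactPM n (q ^ 2)) (∑-signWeight q n) ⟩
  rhs n q ∎
  where open ≡-Reasoning
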